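{- Let $\Gamma$ be a weighted multidigraph on the vertex set $V=\{1,\dots,n\}$ with Kirchhoff matrix $L=L(\Gamma)$, and let $W=I+L$. For any $i,j\in V$, the cofactor $W^{ij}$ of the $(i,j)$-entry of $W$ satisfies $W^{ij}=\varepsilon(\mathcal{F}^{i\to j})$. Here $\mathcal{F}^{i\to j}$ is the set of spanning diverging forests of $\Gamma$ in which $i$ and $j$ belong to the same tree and that tree diverges from (is rooted at) $i$.
   Context: A weighted multidigraph $\Gamma$ on $V=\{1,\dots,n\}$ may have several arcs from $i$ to $j$. Each arc carries a real weight, which may be negative. The Kirchhoff matrix $L=(\ell_{ij})$ has $\ell_{ij}=-(\text{sum of the weights of all arcs from } j \text{ to } i)$ for $i\neq j$, and $\ell_{ii}=-\sum_{j\neq i}\ell_{ij}$. The cofactor $W^{ij}$ is $(-1)^{i+j}$ times the determinant of the matrix obtained from $W$ by deleting row $i$ and column $j$. A diverging tree is a directed tree (one whose underlying undirected graph is a tree) with a marked root, containing a directed path from the root to every other vertex. A spanning diverging forest of $\Gamma$ is a spanning subgraph that is a directed forest each of whose components is a diverging tree with its root marked. The weight $\varepsilon(H)$ of a subgraph is the product of its arc weights, and is $1$ if it has no arcs. For a nonempty set of subgraphs, $\varepsilon$ is the sum of the weights of its members; the empty set has weight $0$. -}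

module Defs where

open import Level using (Level; _⊔_)
open import Data.Nat using (ℕ; zero; suc) renaming (_+_ to _+ℕ_)
open import Data.Fin using (Fin; zero; suc; toℕ; punchIn; _≟_)
open import Data.Fin.Subset using (Subset; _∈_)
open import Data.Vec using (lookup)
open import Data.Bool using (Bool; true; false; if_then_else_)
open import Data.List using (List; []; _∷_)
open import Data.List.Relation.Unary.Unique.Propositional using (Unique)
open import Data.Product using (_×_; ∃; Σ)
open import Relation.Nullary using (¬_; does)
open import Relation.Binary.PropositionalEquality using (_≡_)
open import Algebra.Bundles using (CommutativeRing)

record Multidigraph {a : Level} (A : Set a) (n : ℕ) : Set a where
  field
    nArcs : ℕ
    src   : Fin nArcs → Fin n
    tgt   : Fin nArcs → Fin n
    wt    : Fin nArcs → A

open Multidigraph public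

-- Combinatorial notions (independent of weights).
-- A spanning subgraph is determined by its arc set S : Subset (nArcs Γ).

module _ {a : Level} {A : Set a} {n : ℕ} (Γ : Multidigraph A n) where

  -- directed walks (existence of a walk ⇔ existence of a directed path)
  data Reach (S : Subset (nArcs Γ)) : Fin n → Fin n → Set where
    here : ∀ {u} → Reach S u u
    step : ∀ {u v} (e : Fin (nArcs Γ)) → e ∈ S → src Γ e ≡ u →
           Reach S (tgt Γ e) v → Reach S u v

  data UWalk (S : Subset (nArcs Γ)) : Fin n → Fin n → List (Fin (nArcs Γ)) → Set where
    nil : ∀ {u} → UWalk S u u []
    fwd : ∀ {u v es} (e : Fin (nArcs Γ)) → e ∈ S → src Γ e ≡ u →
          UWalk S (tgt Γ e) v es → UWalk S u v (e ∷ es)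
    bwd : ∀ {u v es} (e : Fin (nArcs Γ)) → e ∈ S → tgt Γ e ≡ u →
          UWalk S (src Γ e) v es → UWalk S u v (e ∷ es)

  Connected : Subset (nArcs Γ) → Fin n → Fin n → Set
  Connected S u v = ∃ λ es → UWalk S u v es

  -- directed forest: the underlying undirected multigraph has no cycle,
  -- i.e. no nonempty closed walk with pairwise distinct arcs
  -- (a loop or a pair of parallel arcs counts as a cycle).
  IsDirectedForest : Subset (nArcs Γ) → Set
  IsDirectedForest S = ∀ u es → UWalk S u u es → Unique es → es ≡ []

  DivergesFrom : Subset (nArcs Γ) → Fin n → Fin n → Set
  DivergesFrom S r u = Connected S r u × (∀ v → Connected S u v → Reach S r v)

  IsSpanningDivergingForest : Subset (nArcs Γ) → Set
  IsSpanningDivergingForest S =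
    IsDirectedForest S × (∀ u → ∃ λ r → DivergesFrom S r u)

  InF : Fin n → Fin n → Subset (nArcs Γ) → Set
  InF i j S = IsSpanningDivergingForest S × Connected S i j × DivergesFrom S i i

module _ {c ℓ : Level} (R : CommutativeRing c ℓ) where
  open CommutativeRing R hiding (zero)

  Σᶠ : ∀ {k} → (Fin k → Carrier) → Carrier
  Σᶠ {zero}  f = 0#
  Σᶠ {suc k} f = f zero + Σᶠ (λ x → f (suc x))

  Πᶠ : ∀ {k} → (Fin k → Carrier) → Carrier
  Πᶠ {zero}  f = 1#
  Πᶠ {suc k} f = f zero * Πᶠ (λ x → f (suc x))

  sumList : List Carrier → Carrier
  sumList []       = 0#
  sumList (x ∷ xs) = x + sumList xs

  sign : ℕ → Carrier
  sign zero    = 1#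
  sign (suc k) = - sign k

  Matrix : ℕ → Set c
  Matrix k = Fin k → Fin k → Carrier

  minor : ∀ {k} → Matrix (suc k) → Fin (suc k) → Fin (suc k) → Matrix k
  minor M i j r s = M (punchIn i r) (punchIn j s)

  det : ∀ {k} → Matrix k → Carrier
  det {zero}  M = 1#
  det {suc k} M = Σᶠ (λ j → sign (toℕ j) * (M zero j * det (minor M zero j)))

  cofactor : ∀ {k} → Matrix k → Fin k → Fin k → Carrier
  cofactor {suc k} M i j = sign (toℕ i +ℕ toℕ j) * det (minor M i j)

  identity : ∀ {k} → Matrix k
  identity i j = if does (i ≟ j) then 1# else 0#

  module _ {n : ℕ} (Γ : Multidigraph Carrier n) where

    arcSum : Fin n → Fin n → Carrier
    arcSum u v = Σᶠ (λ e → if does (src Γ e ≟ u) then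
                             (if does (tgt Γ e ≟ v) then wt Γ e else 0#)
                           else 0#)

    offDiag : Fin n → Fin n → Carrier
    offDiag i j = if does (i ≟ j) then 0# else - arcSum j i

    kirchhoff : Matrix n
    kirchhoff i j = if does (i ≟ j) then - Σᶠ (λ k → offDiag i k) else offDiag i j

    Wmat : Matrix n
    Wmat i j = identity i j + kirchhoff i j

    ε : Subset (nArcs Γ) → Carrier
    ε S = Πᶠ (λ e → if lookup S e then wt Γ e else 1#)

module Submission where

-- Replacing row i of W = I + L by the unit row e_j gives a matrix with determinant W^{ij}.  The
-- row of v in W is e_v + Σ w_a (e_v − e_u), summed over the arcs a = (u → v), so expanding by
-- multilinearity one arc at a time writes the determinant as a sum over arc sets S: keeping the
-- arc a contributes w_a times the determinant in which the row of v is e_v − e_u, that is, in which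
-- u has become the parent of v, and a second arc into v then contributes nothing.  Rows along a
-- cycle of parent pointers add up to zero, and arcs into i only touch the replaced row, so only
-- acyclic parent maps in which i is a root survive.  For those, row operations along the parent
-- pointers show that I − P with row i replaced by e_j has determinant 1 if i is an ancestor of j
-- and 0 otherwise.  The arc sets that survive with value ε(S) are exactly the spanning diverging
-- forests in which the tree containing j is rooted at i.

open import Defs
open import Level using (Level)
open import Data.Nat using (ℕ; zero; suc) renaming (_+_ to _+ℕ_)
open import Data.Fin using (Fin; zero; suc; toℕ; punchIn; punchOut; _≟_)
open import Data.Fin.Properties using (suc-injective; punchInᵢ≢i; punchIn-punchOut; punchOut-punchIn; punchOut-cong)
open import Data.Fin.Subset using (Subset) renaming (_∈_ to _∈ₛ_)
open import Data.Bool using (Bool; true; false; if_then_else_)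
open import Data.Bool.Properties using (⇔→≡) renaming (_≟_ to _≟ᵇ_)
open import Data.Maybe using (Maybe; just; nothing)
open import Data.Maybe.Properties using (just-injective)
open import Data.Product using (_×_; _,_; proj₁; proj₂; ∃; Σ-syntax)
open import Data.Sum using (_⊎_; inj₁; inj₂)
open import Data.Empty using (⊥; ⊥-elim)
open import Data.List using (List; []; _∷_; _++_; map; allFin; tabulate; catMaybes)
open import Data.List.Membership.Propositional using () renaming (_∈_ to _∈ˡ_; _∉_ to _∉ˡ_)
open import Data.List.Membership.Propositional.Properties using (∈-allFin; ∈-++⁺ʳ; ∈-++⁻)
open import Data.List.Relation.Unary.Any using (here; there; any?)
open import Data.List.Relation.Unary.All as All using (All; []; _∷_)
import Data.List.Relation.Unary.All.Properties as All
open import Data.List.Relation.Unary.AllPairs using ([]; _∷_)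
open import Data.List.Relation.Unary.Unique.Propositional using (Unique)
open import Data.List.Relation.Binary.Subset.Propositional using (_⊆_)
open import Data.Vec using ([]; _∷_; lookup)
open import Data.Vec.Properties using (≡-dec; ∷-injectiveʳ; []=⇒lookup; lookup⇒[]=)
open import Function using (_∘_)
open import Function.Definitions using (Injective)
open import Function.Bundles using (_⇔_; mk⇔; Equivalence)
import Function.Properties.Equivalence as ⇔
open import Relation.Nullary using (¬_; Dec; does; yes; no)
open import Relation.Binary.PropositionalEquality as ≡ using (_≡_; _≢_)
open import Relation.Binary.Definitions using (DecidableEquality)
open import Algebra.Bundles using (CommutativeRing)

punchIn-punchIn-comm : ∀ {k} (j c : Fin (suc (suc k))) (j≢c : j ≢ c) (c≢j : c ≢ j) (s : Fin k) →
                       punchIn j (punchIn (punchOut j≢c) s) ≡ punchIn c (punchIn (punchOut c≢j) s)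
punchIn-punchIn-comm zero    zero    j≢c c≢j s = ⊥-elim (j≢c ≡.refl)
punchIn-punchIn-comm zero    (suc c) j≢c c≢j s = ≡.refl
punchIn-punchIn-comm (suc j) zero    j≢c c≢j s = ≡.refl
punchIn-punchIn-comm {suc k} (suc j) (suc c) j≢c c≢j zero    = ≡.refl
punchIn-punchIn-comm {suc k} (suc j) (suc c) j≢c c≢j (suc s) =
  ≡.cong suc (punchIn-punchIn-comm j c (j≢c ∘ ≡.cong suc) (c≢j ∘ ≡.cong suc) s)

module RingFacts {c ℓ} (R : CommutativeRing c ℓ) where
  open CommutativeRing R hiding (zero)
  open import Algebra.Properties.Ring ring public
    using (-0#≈0#; -‿involutive; -‿distribˡ-*; -‿distribʳ-*; -‿+-comm; x+x≈x⇒x≈0)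
  open import Algebra.Solver.Ring.NaturalCoefficients.Default commutativeSemiring public
    using (solve; _:+_; _:*_; _:=_)
  open import Relation.Binary.Reasoning.Setoid setoid

  -x*-y≈x*y : ∀ x y → - x * - y ≈ x * y
  -x*-y≈x*y x y = begin
    - x * - y     ≈⟨ -‿distribˡ-* x (- y) ⟨
    - (x * - y)   ≈⟨ -‿cong (-‿distribʳ-* x y) ⟨
    - - (x * y)   ≈⟨ -‿involutive _ ⟩
    x * y         ∎

  x-0≈x : ∀ x → x - 0# ≈ x
  x-0≈x x = trans (+-congˡ -0#≈0#) (+-identityʳ x)

  -- stated with the factor 1# to match the premise of det-add-row
  x-z≈x-y+1*y-z : ∀ x y z → x - z ≈ (x - y) + 1# * (y - z)
  x-z≈x-y+1*y-z x y z = sym (begin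
    (x - y) + 1# * (y - z)   ≈⟨ +-congˡ (*-identityˡ _) ⟩
    (x + - y) + (y + - z)    ≈⟨ solve 4 (λ x ny y nz → (x :+ ny) :+ (y :+ nz) := (x :+ nz) :+ (y :+ ny)) refl x (- y) y (- z) ⟩
    (x + - z) + (y + - y)    ≈⟨ +-congˡ (-‿inverseʳ y) ⟩
    (x + - z) + 0#           ≈⟨ +-identityʳ _ ⟩
    x - z                    ∎)

  x≈y+1*[x-y] : ∀ x y → x ≈ y + 1# * (x - y)
  x≈y+1*[x-y] x y = sym (begin
    y + 1# * (x - y)   ≈⟨ +-congˡ (*-identityˡ _) ⟩
    y + (x + - y)      ≈⟨ solve 3 (λ y x ny → y :+ (x :+ ny) := x :+ (y :+ ny)) refl y x (- y) ⟩
    x + (y + - y)      ≈⟨ +-congˡ (-‿inverseʳ y) ⟩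
    x + 0#             ≈⟨ +-identityʳ x ⟩
    x                  ∎)

  if-distribˡ : ∀ (b : Bool) x y → (if b then x * y else 0#) ≈ x * (if b then y else 0#)
  if-distribˡ true  x y = refl
  if-distribˡ false x y = sym (zeroʳ x)

  sign-square : ∀ k → sign R k * sign R k ≈ 1#
  sign-square zero    = *-identityʳ 1#
  sign-square (suc k) = trans (-x*-y≈x*y _ _) (sign-square k)

  sign-+ : ∀ a b → sign R (a +ℕ b) ≈ sign R a * sign R b
  sign-+ zero    b = sym (*-identityˡ _)
  sign-+ (suc a) b = trans (-‿cong (sign-+ a b)) (-‿distribˡ-* _ _)

  sign*x≈0⇒x≈0 : ∀ k {x} → sign R k * x ≈ 0# → x ≈ 0#
  sign*x≈0⇒x≈0 k {x} eq = begin
    x                              ≈⟨ *-identityˡ x ⟨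
    1# * x                         ≈⟨ *-congʳ (sign-square k) ⟨
    (sign R k * sign R k) * x      ≈⟨ *-assoc _ _ _ ⟩
    sign R k * (sign R k * x)      ≈⟨ *-congˡ eq ⟩
    sign R k * 0#                  ≈⟨ zeroʳ _ ⟩
    0#                             ∎

module FinSums {c ℓ} (R : CommutativeRing c ℓ) where
  open CommutativeRing R hiding (zero)
  open RingFacts R
  open import Algebra.Properties.Semiring.Sum semiring
    using (sum; sum-cong-≋; ∑-distrib-+; ∑-comm; sum-remove; *-distribˡ-sum; sum-replicate-zero)
  open import Relation.Binary.Reasoning.Setoid setoid

  Σᶠ≡sum : ∀ {k} (f : Fin k → Carrier) → Σᶠ R f ≡ sum f
  Σᶠ≡sum {zero}  f = ≡.refl
  Σᶠ≡sum {suc k} f = ≡.cong (f zero +_) (Σᶠ≡sum (f ∘ suc))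

  Σᶠ-cong : ∀ {k} {f g : Fin k → Carrier} → (∀ x → f x ≈ g x) → Σᶠ R f ≈ Σᶠ R g
  Σᶠ-cong {f = f} {g} f≈g rewrite Σᶠ≡sum f | Σᶠ≡sum g = sum-cong-≋ f≈g

  Σᶠ-zero : ∀ {k} {f : Fin k → Carrier} → (∀ x → f x ≈ 0#) → Σᶠ R f ≈ 0#
  Σᶠ-zero {k} {f} f≈0 rewrite Σᶠ≡sum f = trans (sum-cong-≋ f≈0) (sum-replicate-zero k)

  Σᶠ-distrib-+ : ∀ {k} (f g : Fin k → Carrier) → Σᶠ R (λ x → f x + g x) ≈ Σᶠ R f + Σᶠ R g
  Σᶠ-distrib-+ f g rewrite Σᶠ≡sum (λ x → f x + g x) | Σᶠ≡sum f | Σᶠ≡sum g = ∑-distrib-+ f g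

  *-distribˡ-Σᶠ : ∀ {k} x (f : Fin k → Carrier) → x * Σᶠ R f ≈ Σᶠ R (λ y → x * f y)
  *-distribˡ-Σᶠ x f rewrite Σᶠ≡sum f | Σᶠ≡sum (λ y → x * f y) = *-distribˡ-sum x f

  Σᶠ-comm : ∀ {k l} (f : Fin k → Fin l → Carrier) →
            Σᶠ R (λ x → Σᶠ R (f x)) ≈ Σᶠ R (λ y → Σᶠ R (λ x → f x y))
  Σᶠ-comm f = begin
    Σᶠ R (λ x → Σᶠ R (f x))          ≈⟨ Σᶠ-cong (λ x → reflexive (Σᶠ≡sum (f x))) ⟩
    Σᶠ R (λ x → sum (f x))           ≡⟨ Σᶠ≡sum (λ x → sum (f x)) ⟩
    sum (λ x → sum (f x))            ≈⟨ ∑-comm f ⟩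
    sum (λ y → sum (λ x → f x y))    ≡⟨ Σᶠ≡sum (λ y → sum (λ x → f x y)) ⟨
    Σᶠ R (λ y → sum (λ x → f x y))   ≈⟨ Σᶠ-cong (λ y → reflexive (≡.sym (Σᶠ≡sum (λ x → f x y)))) ⟩
    Σᶠ R (λ y → Σᶠ R (λ x → f x y))  ∎

  Σᶠ-remove : ∀ {k} (j : Fin (suc k)) (f : Fin (suc k) → Carrier) → Σᶠ R f ≈ f j + Σᶠ R (f ∘ punchIn j)
  Σᶠ-remove j f rewrite Σᶠ≡sum f | Σᶠ≡sum (f ∘ punchIn j) = sum-remove f

  -‿distrib-Σᶠ : ∀ {k} (f : Fin k → Carrier) → - Σᶠ R f ≈ Σᶠ R (λ x → - f x)
  -‿distrib-Σᶠ {zero}  f = -0#≈0#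
  -‿distrib-Σᶠ {suc k} f = trans (sym (-‿+-comm _ _)) (+-congˡ (-‿distrib-Σᶠ (f ∘ suc)))

  identity-diag : ∀ {k} (x : Fin k) → identity R x x ≈ 1#
  identity-diag x with x ≟ x
  ... | yes _  = refl
  ... | no x≢x = ⊥-elim (x≢x ≡.refl)

  identity-off : ∀ {k} {x y : Fin k} → x ≢ y → identity R x y ≈ 0#
  identity-off {x = x} {y} x≢y with x ≟ y
  ... | yes x≡y = ⊥-elim (x≢y x≡y)
  ... | no _    = refl

  identity-sym : ∀ {k} (x y : Fin k) → identity R x y ≈ identity R y x
  identity-sym x y with x ≟ y | y ≟ x
  ... | yes _   | yes _   = refl
  ... | no _    | no _    = refl
  ... | yes x≡y | no y≢x = ⊥-elim (y≢x (≡.sym x≡y))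
  ... | no x≢y | yes y≡x = ⊥-elim (x≢y (≡.sym y≡x))

  Σᶠ-select : ∀ {k} (j : Fin k) (f : Fin k → Carrier) → Σᶠ R (λ x → identity R j x * f x) ≈ f j
  Σᶠ-select {suc k} j f = begin
    Σᶠ R (λ x → identity R j x * f x)
      ≈⟨ Σᶠ-remove j (λ x → identity R j x * f x) ⟩
    identity R j j * f j + Σᶠ R (λ l → identity R j (punchIn j l) * f (punchIn j l))
      ≈⟨ +-cong (*-congʳ (identity-diag j)) (Σᶠ-zero (λ l → trans (*-congʳ (identity-off (punchInᵢ≢i j l ∘ ≡.sym))) (zeroˡ _))) ⟩
    1# * f j + 0#
      ≈⟨ trans (+-identityʳ _) (*-identityˡ _) ⟩
    f j ∎

  -- needs no division by 2: the diagonal and each pair {x, y} cancel separately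
  Σᶠ-antisymmetric : ∀ {k} (F : Fin k → Fin k → Carrier) →
    (∀ x → F x x ≈ 0#) → (∀ x y → F x y + F y x ≈ 0#) → Σᶠ R (λ x → Σᶠ R (F x)) ≈ 0#
  Σᶠ-antisymmetric {zero}  F diag anti = refl
  Σᶠ-antisymmetric {suc k} F diag anti = begin
    (F zero zero + Σᶠ R (λ y → F zero (suc y))) + Σᶠ R (λ x → F (suc x) zero + Σᶠ R (λ y → F (suc x) (suc y)))
      ≈⟨ +-cong (+-congʳ (diag zero)) (Σᶠ-distrib-+ (λ x → F (suc x) zero) (λ x → Σᶠ R (λ y → F (suc x) (suc y)))) ⟩
    (0# + Σᶠ R (λ y → F zero (suc y))) + (Σᶠ R (λ x → F (suc x) zero) + Σᶠ R (λ x → Σᶠ R (λ y → F (suc x) (suc y))))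
      ≈⟨ +-cong (+-identityˡ _) (+-congˡ (Σᶠ-antisymmetric (λ x y → F (suc x) (suc y)) (diag ∘ suc) (λ x y → anti (suc x) (suc y)))) ⟩
    Σᶠ R (λ y → F zero (suc y)) + (Σᶠ R (λ x → F (suc x) zero) + 0#)
      ≈⟨ +-congˡ (+-identityʳ _) ⟩
    Σᶠ R (λ y → F zero (suc y)) + Σᶠ R (λ x → F (suc x) zero)
      ≈⟨ Σᶠ-distrib-+ (λ y → F zero (suc y)) (λ y → F (suc y) zero) ⟨
    Σᶠ R (λ y → F zero (suc y) + F (suc y) zero)
      ≈⟨ Σᶠ-zero (λ y → anti zero (suc y)) ⟩
    0# ∎

module Determinants {c ℓ} (R : CommutativeRing c ℓ) where
  open CommutativeRing R hiding (zero)
  open RingFacts R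
  open FinSums R
  open import Relation.Binary.Reasoning.Setoid setoid

  RowsAgreeExcept : ∀ {k} → Fin k → Matrix R k → Matrix R k → Set ℓ
  RowsAgreeExcept p A B = ∀ r → r ≢ p → ∀ s → A r s ≈ B r s

  laplaceTerm : ∀ {k} → Matrix R (suc k) → Fin (suc k) → Carrier
  laplaceTerm A j = sign R (toℕ j) * (A zero j * det R (minor R A zero j))

  det-cong : ∀ {k} {A B : Matrix R k} → (∀ r s → A r s ≈ B r s) → det R A ≈ det R B
  det-cong {zero}  A≈B = refl
  det-cong {suc k} A≈B = Σᶠ-cong λ j →
    *-congˡ {sign R (toℕ j)} (*-cong (A≈B zero j) (det-cong λ r s → A≈B (suc r) (punchIn j s)))

  det-linear : ∀ {k} (p : Fin k) (w : Carrier) {A B C : Matrix R k} →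
    RowsAgreeExcept p A B → RowsAgreeExcept p A C → (∀ s → A p s ≈ B p s + w * C p s) →
    det R A ≈ det R B + w * det R C
  laplaceTerm-linear : ∀ {k} (p : Fin (suc k)) (w : Carrier) {A B C : Matrix R (suc k)} →
    RowsAgreeExcept p A B → RowsAgreeExcept p A C → (∀ s → A p s ≈ B p s + w * C p s) →
    ∀ j → laplaceTerm A j ≈ laplaceTerm B j + w * laplaceTerm C j

  det-linear {suc k} p w {A} {B} {C} A~B A~C Aₚ = begin
    Σᶠ R (laplaceTerm A)                                ≈⟨ Σᶠ-cong (laplaceTerm-linear p w A~B A~C Aₚ) ⟩
    Σᶠ R (λ j → laplaceTerm B j + w * laplaceTerm C j)  ≈⟨ Σᶠ-distrib-+ (laplaceTerm B) (λ j → w * laplaceTerm C j) ⟩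
    det R B + Σᶠ R (λ j → w * laplaceTerm C j)          ≈⟨ +-congˡ (*-distribˡ-Σᶠ w (laplaceTerm C)) ⟨
    det R B + w * det R C                               ∎

  laplaceTerm-linear zero w {A} {B} {C} A~B A~C A₀ j = begin
    σ * (A zero j * det R (minor R A zero j))                  ≈⟨ *-congˡ (*-cong (A₀ j) A≈B) ⟩
    σ * ((B zero j + w * C zero j) * det R (minor R B zero j)) ≈⟨ distribute σ (B zero j) (C zero j) _ ⟩
    σ * (B zero j * det R (minor R B zero j)) + w * (σ * (C zero j * det R (minor R B zero j)))
      ≈⟨ +-congˡ (*-congˡ (*-congˡ (*-congˡ (trans (sym A≈B) A≈C)))) ⟩
    laplaceTerm B j + w * laplaceTerm C j ∎
    where
    σ = sign R (toℕ j)
    A≈B = det-cong λ r s → A~B (suc r) (λ ()) (punchIn j s)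
    A≈C = det-cong λ r s → A~C (suc r) (λ ()) (punchIn j s)
    distribute : ∀ σ b c d → σ * ((b + w * c) * d) ≈ σ * (b * d) + w * (σ * (c * d))
    distribute σ b c d =
      solve 5 (λ σ b c d w → σ :* ((b :+ w :* c) :* d) := σ :* (b :* d) :+ w :* (σ :* (c :* d))) refl σ b c d w
  laplaceTerm-linear {suc k} (suc p) w {A} {B} {C} A~B A~C Aₚ j = begin
    σ * (A zero j * det R (minor R A zero j))
      ≈⟨ *-congˡ (*-congˡ (det-linear p w (λ r r≢p s → A~B (suc r) (r≢p ∘ suc-injective) (punchIn j s))
                                           (λ r r≢p s → A~C (suc r) (r≢p ∘ suc-injective) (punchIn j s))
                                           (λ s → Aₚ (punchIn j s)))) ⟩
    σ * (A zero j * (det R (minor R B zero j) + w * det R (minor R C zero j)))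
      ≈⟨ distribute σ (A zero j) _ _ ⟩
    σ * (A zero j * det R (minor R B zero j)) + w * (σ * (A zero j * det R (minor R C zero j)))
      ≈⟨ +-cong (*-congˡ (*-congʳ (A~B zero (λ ()) j))) (*-congˡ (*-congˡ (*-congʳ (A~C zero (λ ()) j)))) ⟩
    laplaceTerm B j + w * laplaceTerm C j ∎
    where
    σ = sign R (toℕ j)
    distribute : ∀ σ a x y → σ * (a * (x + w * y)) ≈ σ * (a * x) + w * (σ * (a * y))
    distribute σ a x y =
      solve 5 (λ σ a x y w → σ :* (a :* (x :+ w :* y)) := σ :* (a :* x) :+ w :* (σ :* (a :* y))) refl σ a x y w

  det-zero-row : ∀ {k} (p : Fin k) {A : Matrix R k} → (∀ s → A p s ≈ 0#) → det R A ≈ 0#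
  det-zero-row p {A} Aₚ≈0 = x+x≈x⇒x≈0 (det R A) (sym (begin
    det R A                 ≈⟨ det-linear p 1# (λ _ _ _ → refl) (λ _ _ _ → refl) doubled ⟩
    det R A + 1# * det R A  ≈⟨ +-congˡ (*-identityˡ _) ⟩
    det R A + det R A       ∎))
    where
    doubled : ∀ s → A p s ≈ A p s + 1# * A p s
    doubled s = trans (Aₚ≈0 s) (sym (trans (+-cong (Aₚ≈0 s) (trans (*-congˡ (Aₚ≈0 s)) (zeroʳ 1#))) (+-identityʳ 0#)))

  det-identity : ∀ {k} {A : Matrix R k} → (∀ r s → A r s ≈ identity R r s) → det R A ≈ 1#
  det-identity {zero}  A≈I = refl
  det-identity {suc k} {A} A≈I = begin
    1# * (A zero zero * det R (minor R A zero zero)) + Σᶠ R (laplaceTerm A ∘ suc)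
      ≈⟨ +-cong (*-congˡ (*-cong (A≈I zero zero) (det-identity (λ r s → A≈I (suc r) (suc s)))))
                (Σᶠ-zero (λ j → trans (*-congˡ (trans (*-congʳ (A≈I zero (suc j))) (zeroˡ _))) (zeroʳ _))) ⟩
    1# * (1# * 1#) + 0#
      ≈⟨ trans (+-identityʳ _) (trans (*-identityˡ _) (*-identityˡ 1#)) ⟩
    1# ∎

  sign-punchOut-antisym : ∀ {k} (j c : Fin (suc (suc k))) (j≢c : j ≢ c) (c≢j : c ≢ j) →
    sign R (toℕ j) * sign R (toℕ (punchOut j≢c)) ≈ - (sign R (toℕ c) * sign R (toℕ (punchOut c≢j)))
  sign-punchOut-antisym zero zero j≢c c≢j = ⊥-elim (j≢c ≡.refl)
  sign-punchOut-antisym zero (suc c) j≢c c≢j = begin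
    1# * sign R (toℕ c)           ≈⟨ *-identityˡ _ ⟩
    sign R (toℕ c)                ≈⟨ -‿involutive _ ⟨
    - - sign R (toℕ c)            ≈⟨ -‿cong (*-identityʳ _) ⟨
    - (- sign R (toℕ c) * 1#)     ∎
  sign-punchOut-antisym (suc j) zero j≢c c≢j = begin
    - sign R (toℕ j) * 1#         ≈⟨ *-identityʳ _ ⟩
    - sign R (toℕ j)              ≈⟨ -‿cong (*-identityˡ _) ⟨
    - (1# * sign R (toℕ j))       ∎
  sign-punchOut-antisym {zero} (suc zero) (suc zero) j≢c c≢j = ⊥-elim (j≢c ≡.refl)
  sign-punchOut-antisym {suc k} (suc j) (suc c) j≢c c≢j = begin
    - sign R (toℕ j) * - sign R (toℕ (punchOut j≢c′))    ≈⟨ -x*-y≈x*y _ _ ⟩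
    sign R (toℕ j) * sign R (toℕ (punchOut j≢c′))        ≈⟨ sign-punchOut-antisym j c j≢c′ c≢j′ ⟩
    - (sign R (toℕ c) * sign R (toℕ (punchOut c≢j′)))    ≈⟨ -‿cong (-x*-y≈x*y _ _) ⟨
    - (- sign R (toℕ c) * - sign R (toℕ (punchOut c≢j′))) ∎
    where
    j≢c′ = j≢c ∘ ≡.cong suc
    c≢j′ = c≢j ∘ ≡.cong suc

  -- Expanding along rows 0 and 1 at once: the term for the columns (j , c) of rows (0 , 1)
  -- and the term for (c , j) share the minor and have opposite signs.
  module TwoRowExpansion {k} (A : Matrix R (suc (suc k))) where
    minor₀₁ : Fin (suc (suc k)) → Fin (suc k) → Matrix R k
    minor₀₁ j l = minor R (minor R A zero j) zero l

    term : Fin (suc (suc k)) → Fin (suc k) → Carrier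
    term j l = sign R (toℕ j) * (A zero j * laplaceTerm (minor R A zero j) l)

    pairTerm : Fin (suc (suc k)) → Fin (suc (suc k)) → Carrier
    pairTerm j c with j ≟ c
    ... | yes _   = 0#
    ... | no j≢c = term j (punchOut j≢c)

    pairTerm-diag : ∀ j → pairTerm j j ≈ 0#
    pairTerm-diag j with j ≟ j
    ... | yes _  = refl
    ... | no j≢j = ⊥-elim (j≢j ≡.refl)

    pairTerm-punchIn : ∀ j l → pairTerm j (punchIn j l) ≈ term j l
    pairTerm-punchIn j l with j ≟ punchIn j l
    ... | yes j≡ = ⊥-elim (punchInᵢ≢i j l (≡.sym j≡))
    ... | no j≢  = reflexive (≡.cong (term j) (≡.trans (punchOut-cong j ≡.refl) (punchOut-punchIn j)))

    det≈ΣΣpairTerm : det R A ≈ Σᶠ R (λ j → Σᶠ R (pairTerm j))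
    det≈ΣΣpairTerm = Σᶠ-cong λ j → begin
      laplaceTerm A j                               ≈⟨ *-congˡ (*-distribˡ-Σᶠ (A zero j) (laplaceTerm (minor R A zero j))) ⟩
      sign R (toℕ j) * Σᶠ R (λ l → A zero j * laplaceTerm (minor R A zero j) l)
                                                    ≈⟨ *-distribˡ-Σᶠ (sign R (toℕ j)) (λ l → A zero j * laplaceTerm (minor R A zero j) l) ⟩
      Σᶠ R (term j)                                 ≈⟨ +-identityˡ _ ⟨
      0# + Σᶠ R (term j)                            ≈⟨ +-cong (pairTerm-diag j) (Σᶠ-cong (pairTerm-punchIn j)) ⟨
      pairTerm j j + Σᶠ R (pairTerm j ∘ punchIn j)  ≈⟨ Σᶠ-remove j (pairTerm j) ⟨
      Σᶠ R (pairTerm j)                             ∎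

    module _ (rows₀₁-equal : ∀ s → A zero s ≈ A (suc zero) s) where
      term-symmetric : ∀ j c (j≢c : j ≢ c) → term j (punchOut j≢c) ≈
        (sign R (toℕ j) * sign R (toℕ (punchOut j≢c))) * (A zero j * (A zero c * det R (minor₀₁ j (punchOut j≢c))))
      term-symmetric j c j≢c = begin
        σ * (A zero j * (τ * (A (suc zero) (punchIn j l) * d)))
          ≈⟨ *-congˡ (*-congˡ (*-congˡ (*-congʳ row₁≈row₀))) ⟩
        σ * (A zero j * (τ * (A zero c * d)))
          ≈⟨ solve 5 (λ σ τ x y d → σ :* (x :* (τ :* (y :* d))) := (σ :* τ) :* (x :* (y :* d))) refl
                     σ τ (A zero j) (A zero c) d ⟩
        (σ * τ) * (A zero j * (A zero c * d)) ∎
        where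
        l = punchOut j≢c
        σ = sign R (toℕ j)
        τ = sign R (toℕ l)
        d = det R (minor₀₁ j l)
        row₁≈row₀ : A (suc zero) (punchIn j l) ≈ A zero c
        row₁≈row₀ = trans (reflexive (≡.cong (A (suc zero)) (punchIn-punchOut j≢c))) (sym (rows₀₁-equal c))

      pairTerm-antisym : ∀ j c → pairTerm j c + pairTerm c j ≈ 0#
      pairTerm-antisym j c with j ≟ c | c ≟ j
      ... | yes _   | yes _   = +-identityʳ 0#
      ... | yes j≡c | no c≢j = ⊥-elim (c≢j (≡.sym j≡c))
      ... | no j≢c | yes c≡j = ⊥-elim (j≢c (≡.sym c≡j))
      ... | no j≢c | no c≢j = begin
        term j (punchOut j≢c) + term c (punchOut c≢j)
          ≈⟨ +-cong (term-symmetric j c j≢c) (term-symmetric c j c≢j) ⟩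
        (sign R (toℕ j) * sign R (toℕ (punchOut j≢c))) * (A zero j * (A zero c * det R (minor₀₁ j (punchOut j≢c)))) + σ * x
          ≈⟨ +-congʳ (*-cong (sign-punchOut-antisym j c j≢c c≢j) (trans (x*[y*z]≈y*[x*z] (A zero j) (A zero c) _) same-minor)) ⟩
        - σ * x + σ * x  ≈⟨ +-congʳ (-‿distribˡ-* σ x) ⟨
        - (σ * x) + σ * x ≈⟨ -‿inverseˡ _ ⟩
        0# ∎
        where
        σ = sign R (toℕ c) * sign R (toℕ (punchOut c≢j))
        x = A zero c * (A zero j * det R (minor₀₁ c (punchOut c≢j)))
        x*[y*z]≈y*[x*z] : ∀ x y z → x * (y * z) ≈ y * (x * z)
        x*[y*z]≈y*[x*z] = solve 3 (λ x y z → x :* (y :* z) := y :* (x :* z)) refl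
        same-minor = *-congˡ (*-congˡ (det-cong λ r s →
          reflexive (≡.cong (A (suc (suc r))) (punchIn-punchIn-comm j c j≢c c≢j s))))

  det-equal-rows₀₁ : ∀ {k} (A : Matrix R (suc (suc k))) → (∀ s → A zero s ≈ A (suc zero) s) → det R A ≈ 0#
  det-equal-rows₀₁ A rows₀₁-equal =
    trans det≈ΣΣpairTerm (Σᶠ-antisymmetric pairTerm pairTerm-diag (pairTerm-antisym rows₀₁-equal))
    where open TwoRowExpansion A

  withRows₀₁ : ∀ {k} → (Fin (suc (suc k)) → Carrier) → (Fin (suc (suc k)) → Carrier) →
               Matrix R (suc (suc k)) → Matrix R (suc (suc k))
  withRows₀₁ u v A zero                = u
  withRows₀₁ u v A (suc zero)          = v
  withRows₀₁ u v A (suc (suc r))       = A (suc (suc r))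

  det-withRows₀₁-linearˡ : ∀ {k} (u u′ v : Fin (suc (suc k)) → Carrier) A →
    det R (withRows₀₁ (λ s → u s + u′ s) v A) ≈ det R (withRows₀₁ u v A) + det R (withRows₀₁ u′ v A)
  det-withRows₀₁-linearˡ u u′ v A =
    trans (det-linear zero 1# agree agree (λ s → +-congˡ (sym (*-identityˡ _)))) (+-congˡ (*-identityˡ _))
    where
    agree : ∀ {w} → RowsAgreeExcept zero (withRows₀₁ (λ s → u s + u′ s) v A) (withRows₀₁ w v A)
    agree zero          0≢0 s = ⊥-elim (0≢0 ≡.refl)
    agree (suc zero)    _   s = refl
    agree (suc (suc r)) _   s = refl

  det-withRows₀₁-linearʳ : ∀ {k} (u v v′ : Fin (suc (suc k)) → Carrier) A →
    det R (withRows₀₁ u (λ s → v s + v′ s) A) ≈ det R (withRows₀₁ u v A) + det R (withRows₀₁ u v′ A)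
  det-withRows₀₁-linearʳ u v v′ A =
    trans (det-linear (suc zero) 1# agree agree (λ s → +-congˡ (sym (*-identityˡ _)))) (+-congˡ (*-identityˡ _))
    where
    agree : ∀ {w} → RowsAgreeExcept (suc zero) (withRows₀₁ u (λ s → v s + v′ s) A) (withRows₀₁ u w A)
    agree zero          _   s = refl
    agree (suc zero)    1≢1 s = ⊥-elim (1≢1 ≡.refl)
    agree (suc (suc r)) _   s = refl

  -- 0 = det [u+v; u+v] = det [u; u] + det [u; v] + det [v; u] + det [v; v]
  det-swap₀₁ : ∀ {k} (A : Matrix R (suc (suc k))) → det R (withRows₀₁ (A (suc zero)) (A zero) A) ≈ - det R A
  det-swap₀₁ A = +-inverseʳ-unique (det R A) (det R Avu) (begin
    det R A + det R Avu
      ≈⟨ +-cong (det-cong A≈Auv) refl ⟩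
    det R Auv + det R Avu
      ≈⟨ +-cong (+-identityˡ _) (+-identityʳ _) ⟨
    (0# + det R Auv) + (det R Avu + 0#)
      ≈⟨ +-cong (+-congʳ (det-equal-rows₀₁ Auu λ _ → refl)) (+-congˡ (det-equal-rows₀₁ Avv λ _ → refl)) ⟨
    (det R Auu + det R Auv) + (det R Avu + det R Avv)
      ≈⟨ +-cong (det-withRows₀₁-linearʳ u u v A) (det-withRows₀₁-linearʳ v u v A) ⟨
    det R (withRows₀₁ u u+v A) + det R (withRows₀₁ v u+v A)
      ≈⟨ det-withRows₀₁-linearˡ u v u+v A ⟨
    det R (withRows₀₁ u+v u+v A)
      ≈⟨ det-equal-rows₀₁ (withRows₀₁ u+v u+v A) (λ _ → refl) ⟩
    0# ∎)
    where
    open import Algebra.Properties.Ring ring using (+-inverseʳ-unique)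
    u = A zero
    v = A (suc zero)
    u+v = λ s → u s + v s
    Auu = withRows₀₁ u u A
    Auv = withRows₀₁ u v A
    Avu = withRows₀₁ v u A
    Avv = withRows₀₁ v v A
    A≈Auv : ∀ r s → A r s ≈ Auv r s
    A≈Auv zero          s = refl
    A≈Auv (suc zero)    s = refl
    A≈Auv (suc (suc r)) s = refl

  moveRowToTop : ∀ {k} {Row : Set c} → Fin (suc k) → (Fin (suc k) → Row) → Fin (suc k) → Row
  moveRowToTop i A zero    = A i
  moveRowToTop i A (suc r) = A (punchIn i r)

  moveRowToSecond : ∀ {k} → Fin (suc k) → Matrix R (suc (suc k)) → Matrix R (suc (suc k))
  moveRowToSecond i A zero    = A zero
  moveRowToSecond i A (suc r) = moveRowToTop i (A ∘ suc) r

  det-moveRowToTop : ∀ {k} (i : Fin (suc k)) (A : Matrix R (suc k)) →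
                     det R (moveRowToTop i A) ≈ sign R (toℕ i) * det R A
  det-moveRowToSecond : ∀ {k} (i : Fin (suc k)) (A : Matrix R (suc (suc k))) →
                        det R (moveRowToSecond i A) ≈ sign R (toℕ i) * det R A

  det-moveRowToTop zero A =
    trans (det-cong {A = moveRowToTop zero A} {B = A} λ { zero s → refl ; (suc r) s → refl }) (sym (*-identityˡ _))
  det-moveRowToTop {suc k} (suc i) A = begin
    det R (moveRowToTop (suc i) A)                ≈⟨ det-cong {B = withRows₀₁ (B (suc zero)) (B zero) B} swapped ⟩
    det R (withRows₀₁ (B (suc zero)) (B zero) B)  ≈⟨ det-swap₀₁ B ⟩
    - det R B                                     ≈⟨ -‿cong (det-moveRowToSecond i A) ⟩
    - (sign R (toℕ i) * det R A)                  ≈⟨ -‿distribˡ-* _ _ ⟩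
    - sign R (toℕ i) * det R A                    ∎
    where
    B = moveRowToSecond i A
    swapped : ∀ r s → moveRowToTop (suc i) A r s ≈ withRows₀₁ (B (suc zero)) (B zero) B r s
    swapped zero          s = refl
    swapped (suc zero)    s = refl
    swapped (suc (suc r)) s = refl

  det-moveRowToSecond i A = begin
    Σᶠ R (laplaceTerm (moveRowToSecond i A))       ≈⟨ Σᶠ-cong term≈ ⟩
    Σᶠ R (λ j → sign R (toℕ i) * laplaceTerm A j)  ≈⟨ *-distribˡ-Σᶠ (sign R (toℕ i)) (laplaceTerm A) ⟨
    sign R (toℕ i) * det R A                       ∎
    where
    minor≈ : ∀ j r s → minor R (moveRowToSecond i A) zero j r s ≈ moveRowToTop i (minor R A zero j) r s
    minor≈ j zero    s = refl
    minor≈ j (suc r) s = refl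
    pull : ∀ x y z w → x * (y * (z * w)) ≈ z * (x * (y * w))
    pull = solve 4 (λ x y z w → x :* (y :* (z :* w)) := z :* (x :* (y :* w))) refl
    term≈ : ∀ j → laplaceTerm (moveRowToSecond i A) j ≈ sign R (toℕ i) * laplaceTerm A j
    term≈ j = trans (*-congˡ (*-congˡ (trans (det-cong (minor≈ j)) (det-moveRowToTop i (minor R A zero j))))) (pull _ _ _ _)

  det-equal-rows : ∀ {k} (A : Matrix R k) {a b : Fin k} → a ≢ b → (∀ s → A a s ≈ A b s) → det R A ≈ 0#
  det-equal-rows {suc zero}    A {zero} {zero} a≢b _ = ⊥-elim (a≢b ≡.refl)
  det-equal-rows {suc (suc k)} A {a} {b} a≢b Aa≈Ab =
    sign*x≈0⇒x≈0 (toℕ a) (trans (sym (det-moveRowToTop a A))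
      (sign*x≈0⇒x≈0 (toℕ b′) (trans (sym (det-moveRowToSecond b′ X))
        (det-equal-rows₀₁ (moveRowToSecond b′ X) λ s →
          trans (Aa≈Ab s) (reflexive (≡.cong (λ t → A t s) (≡.sym (punchIn-punchOut a≢b))))))))
    where
    b′ = punchOut a≢b
    X = moveRowToTop a A

  setRow : ∀ {k} → Matrix R k → Fin k → (Fin k → Carrier) → Matrix R k
  setRow A p v r = if does (r ≟ p) then v else A r

  setRow-same : ∀ {k} (A : Matrix R k) p v s → setRow A p v p s ≡ v s
  setRow-same A p v s with p ≟ p
  ... | yes _  = ≡.refl
  ... | no p≢p = ⊥-elim (p≢p ≡.refl)

  setRow-other : ∀ {k} (A : Matrix R k) p v {r} → r ≢ p → ∀ s → setRow A p v r s ≡ A r s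
  setRow-other A p v {r} r≢p s with r ≟ p
  ... | yes r≡p = ⊥-elim (r≢p r≡p)
  ... | no _    = ≡.refl

  -- expand det (setRow A i e_j) along row i, after moving that row to the top
  cofactor≈det-setRow : ∀ {k} (A : Matrix R (suc k)) i j → cofactor R A i j ≈ det R (setRow A i (identity R j))
  cofactor≈det-setRow A i j = sym (begin
    det R X                                                     ≈⟨ *-identityˡ _ ⟨
    1# * det R X                                                ≈⟨ *-congʳ (sign-square (toℕ i)) ⟨
    (sign R (toℕ i) * sign R (toℕ i)) * det R X                 ≈⟨ *-assoc _ _ _ ⟩
    sign R (toℕ i) * (sign R (toℕ i) * det R X)                 ≈⟨ *-congˡ (det-moveRowToTop i X) ⟨
    sign R (toℕ i) * Σᶠ R (laplaceTerm (moveRowToTop i X))      ≈⟨ *-congˡ (Σᶠ-cong term≈) ⟩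
    sign R (toℕ i) * Σᶠ R (λ c → identity R j c * (sign R (toℕ c) * det R (minor R A i c)))
                                                                ≈⟨ *-congˡ (Σᶠ-select j (λ c → sign R (toℕ c) * det R (minor R A i c))) ⟩
    sign R (toℕ i) * (sign R (toℕ j) * det R (minor R A i j))  ≈⟨ *-assoc _ _ _ ⟨
    (sign R (toℕ i) * sign R (toℕ j)) * det R (minor R A i j)  ≈⟨ *-congʳ (sign-+ (toℕ i) (toℕ j)) ⟨
    cofactor R A i j                                            ∎)
    where
    X = setRow A i (identity R j)
    term≈ : ∀ c → laplaceTerm (moveRowToTop i X) c ≈ identity R j c * (sign R (toℕ c) * det R (minor R A i c))
    term≈ c = trans
      (*-congˡ (*-cong (reflexive (setRow-same A i (identity R j) c))
                       (det-cong {B = minor R A i c} λ r s → reflexive (setRow-other A i _ (punchInᵢ≢i i r) (punchIn c s)))))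
      (solve 3 (λ σ δ d → σ :* (δ :* d) := δ :* (σ :* d)) refl _ _ _)

  det-add-row : ∀ {k} {X Y : Matrix R k} {a b : Fin k} (w : Carrier) → a ≢ b →
    (∀ s → X a s ≈ Y a s + w * Y b s) → RowsAgreeExcept a X Y → det R X ≈ det R Y
  det-add-row {X = X} {Y} {a} {b} w a≢b Xₐ X~Y = begin
    det R X                ≈⟨ det-linear a w X~Y X~C (λ s → trans (Xₐ s) (+-congˡ (*-congˡ (sym (C-a s))))) ⟩
    det R Y + w * det R C  ≈⟨ +-congˡ (*-congˡ (det-equal-rows C a≢b λ s → trans (C-a s) (sym (C-b s)))) ⟩
    det R Y + w * 0#       ≈⟨ trans (+-congˡ (zeroʳ w)) (+-identityʳ _) ⟩
    det R Y                ∎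
    where
    C = setRow Y a (Y b)
    C-a : ∀ s → C a s ≈ Y b s
    C-a s = reflexive (setRow-same Y a (Y b) s)
    C-b : ∀ s → C b s ≈ Y b s
    C-b s = reflexive (setRow-other Y a (Y b) (a≢b ∘ ≡.sym) s)
    X~C : RowsAgreeExcept a X C
    X~C r r≢a s = trans (X~Y r r≢a s) (sym (reflexive (setRow-other Y a (Y b) r≢a s)))

module ParentMaps (n : ℕ) where

  Parents : Set
  Parents = Fin n → Maybe (Fin n)

  reparent : Parents → Fin n → Maybe (Fin n) → Parents
  reparent p v m x = if does (x ≟ v) then m else p x

  reparent-same : ∀ p v m → reparent p v m v ≡ m
  reparent-same p v m with v ≟ v
  ... | yes _  = ≡.refl
  ... | no v≢v = ⊥-elim (v≢v ≡.refl)

  reparent-other : ∀ p v m {x} → x ≢ v → reparent p v m x ≡ p x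
  reparent-other p v m {x} x≢v with x ≟ v
  ... | yes x≡v = ⊥-elim (x≢v x≡v)
  ... | no _    = ≡.refl

  reparent-self : ∀ p v x → reparent p v (p v) x ≡ p x
  reparent-self p v x with x ≟ v
  ... | yes ≡.refl = ≡.refl
  ... | no _       = ≡.refl

  noParents : Parents
  noParents _ = nothing

  data Rooted (p : Parents) : Fin n → Set where
    root : ∀ {x} → p x ≡ nothing → Rooted p x
    up   : ∀ {x y} → p x ≡ just y → Rooted p y → Rooted p x

  Acyclic : Parents → Set
  Acyclic p = ∀ x → Rooted p x

  acyclic-noParents : Acyclic noParents
  acyclic-noParents x = root ≡.refl

  data Ancestor (p : Parents) (a : Fin n) : Fin n → Set where
    here : Ancestor p a a
    up   : ∀ {x y} → p x ≡ just y → Ancestor p a y → Ancestor p a x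

  Ancestor-trans : ∀ {p a b x} → Ancestor p a b → Ancestor p b x → Ancestor p a x
  Ancestor-trans a∣b here           = a∣b
  Ancestor-trans a∣b (up px≡y b∣y) = up px≡y (Ancestor-trans a∣b b∣y)

  nothing≢just : ∀ {y : Fin n} → nothing ≢ just y
  nothing≢just ()

  ancestor? : ∀ p a {x} → Rooted p x → Dec (Ancestor p a x)
  ancestor? p a {x} (root px≡∅) with a ≟ x
  ... | yes ≡.refl = yes here
  ... | no a≢x     = no λ { here → a≢x ≡.refl ; (up px≡y _) → nothing≢just (≡.trans (≡.sym px≡∅) px≡y) }
  ancestor? p a {x} (up px≡y rooted) with a ≟ x | ancestor? p a rooted
  ... | yes ≡.refl | _       = yes here
  ... | no _       | yes a∣y = yes (up px≡y a∣y)
  ... | no a≢x     | no a∤y  = no λ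
    { here → a≢x ≡.refl
    ; (up px≡y′ a∣y′) → a∤y (≡.subst (Ancestor p a) (just-injective (≡.trans (≡.sym px≡y′) px≡y)) a∣y′) }

  ¬Ancestor⇒≢ : ∀ {p v x} → ¬ Ancestor p v x → x ≢ v
  ¬Ancestor⇒≢ {p} {v} v∤x x≡v = v∤x (≡.subst (Ancestor p v) (≡.sym x≡v) here)

  acyclic-reparent-root : ∀ {p} → Acyclic p → ∀ v → Acyclic (reparent p v nothing)
  acyclic-reparent-root {p} acyclic v x = go (acyclic x)
    where
    go : ∀ {x} → Rooted p x → Rooted (reparent p v nothing) x
    go {x} rooted with x ≟ v
    ... | yes ≡.refl = root (reparent-same p v nothing)
    go (root px≡∅)      | no x≢v = root (≡.trans (reparent-other p v nothing x≢v) px≡∅)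
    go (up px≡y rooted) | no x≢v = up (≡.trans (reparent-other p v nothing x≢v) px≡y) (go rooted)

  acyclic-reparent : ∀ {p} → Acyclic p → ∀ {v u} → ¬ Ancestor p v u → Acyclic (reparent p v (just u))
  acyclic-reparent {p} acyclic {v} {u} v∤u x = go (acyclic x)
    where
    p′ = reparent p v (just u)
    -- the path from u to its root avoids v, so it survives the update
    fromU : ∀ {x} → Rooted p x → ¬ Ancestor p v x → Rooted p′ x
    fromU (root px≡∅)      v∤x = root (≡.trans (reparent-other p v _ (¬Ancestor⇒≢ v∤x)) px≡∅)
    fromU (up px≡y rooted) v∤x =
      up (≡.trans (reparent-other p v _ (¬Ancestor⇒≢ v∤x)) px≡y) (fromU rooted (v∤x ∘ up px≡y))
    go : ∀ {x} → Rooted p x → Rooted p′ x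
    go {x} rooted with x ≟ v
    ... | yes ≡.refl = up (reparent-same p v _) (fromU (acyclic u) v∤u)
    go (root px≡∅)      | no x≢v = root (≡.trans (reparent-other p v _ x≢v) px≡∅)
    go (up px≡y rooted) | no x≢v = up (≡.trans (reparent-other p v _ x≢v) px≡y) (go rooted)

  -- v lies above x, and the parent w of v lies below x: a cycle
  no-cycle : ∀ {p x v w} → Rooted p x → Ancestor p v x → p v ≡ just w → Ancestor p x w → ⊥
  no-cycle (root px≡∅) here         pv≡w _ = nothing≢just (≡.trans (≡.sym px≡∅) pv≡w)
  no-cycle (root px≡∅) (up px≡y _)  _    _ = nothing≢just (≡.trans (≡.sym px≡∅) px≡y)
  no-cycle {p} {x} (up px≡y rooted) here pv≡w x∣w =
    no-cycle rooted (≡.subst (Ancestor p x) (just-injective (≡.trans (≡.sym pv≡w) px≡y)) x∣w) px≡y here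
  no-cycle {p} (up px≡y rooted) (up px≡y′ v∣y′) pv≡w x∣w =
    no-cycle rooted (≡.subst (Ancestor p _) (just-injective (≡.trans (≡.sym px≡y′) px≡y)) v∣y′) pv≡w
             (Ancestor-trans (up px≡y here) x∣w)

module ForestScan (n : ℕ) (i j : Fin n) where
  open ParentMaps n

  -- each arc (s , v) in turn becomes the parent pointer v ↦ s
  acceptsArcs : (p : Parents) → Acyclic p → List (Fin n × Fin n) → Bool
  acceptsArcs p acyclic [] = does (ancestor? p i (acyclic j))
  acceptsArcs p acyclic ((s , v) ∷ arcs) with p v | v ≟ i | ancestor? p v (acyclic s)
  ... | just _  | _     | _      = false
  ... | nothing | yes _ | _      = false
  ... | nothing | no _  | yes _  = false
  ... | nothing | no _  | no v∤s = acceptsArcs (reparent p v (just s)) (acyclic-reparent acyclic v∤s) arcs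


module ParentMatrices {c ℓ} (R : CommutativeRing c ℓ) (n : ℕ) where
  open CommutativeRing R hiding (zero)
  open RingFacts R
  open FinSums R
  open Determinants R
  open ParentMaps n
  open import Relation.Binary.Reasoning.Setoid setoid

  parentRow : Maybe (Fin n) → Fin n → Carrier
  parentRow nothing  t = 0#
  parentRow (just u) t = identity R u t

  -- I − P for the 0/1 matrix P of the parent pointers
  parentMatrix : Parents → Matrix R n
  parentMatrix p r t = identity R r t - parentRow (p r) t

  parentMatrix-cong : ∀ {p q} → (∀ x → p x ≡ q x) → ∀ r t → parentMatrix p r t ≈ parentMatrix q r t
  parentMatrix-cong p≗q r t = reflexive (≡.cong (λ m → identity R r t - parentRow m t) (p≗q r))

  parentMatrix-root : ∀ p {r} → p r ≡ nothing → ∀ t → parentMatrix p r t ≈ identity R r t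
  parentMatrix-root p {r} pr≡∅ t = trans (reflexive (≡.cong (λ m → identity R r t - parentRow m t) pr≡∅)) (x-0≈x _)

  parentMatrix-reparent-other : ∀ p v m {r} → r ≢ v → ∀ t → parentMatrix (reparent p v m) r t ≈ parentMatrix p r t
  parentMatrix-reparent-other p v m {r} r≢v t =
    reflexive (≡.cong (λ m′ → identity R r t - parentRow m′ t) (reparent-other p v m r≢v))

  -- adding row u to row v replaces the parent u of v by the parent of u
  det-reparent-climb : ∀ {p v u} → u ≢ v →
    det R (parentMatrix (reparent p v (p u))) ≈ det R (parentMatrix (reparent p v (just u)))
  det-reparent-climb {p} {v} {u} u≢v = det-add-row 1# (u≢v ∘ ≡.sym) rowᵥ rest
    where
    rowᵥ : ∀ t → parentMatrix (reparent p v (p u)) v t ≈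
                 parentMatrix (reparent p v (just u)) v t + 1# * parentMatrix (reparent p v (just u)) u t
    rowᵥ t = begin
      identity R v t - parentRow (reparent p v (p u) v) t
        ≡⟨ ≡.cong (λ m → identity R v t - parentRow m t) (reparent-same p v (p u)) ⟩
      identity R v t - parentRow (p u) t
        ≈⟨ x-z≈x-y+1*y-z _ (identity R u t) _ ⟩
      (identity R v t - identity R u t) + 1# * (identity R u t - parentRow (p u) t)
        ≡⟨ ≡.cong₂ (λ m m′ → (identity R v t - parentRow m t) + 1# * (identity R u t - parentRow m′ t))
                   (≡.sym (reparent-same p v (just u))) (≡.sym (reparent-other p v (just u) u≢v)) ⟩
      parentMatrix (reparent p v (just u)) v t + 1# * parentMatrix (reparent p v (just u)) u t ∎
    rest : RowsAgreeExcept v (parentMatrix (reparent p v (p u))) (parentMatrix (reparent p v (just u)))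
    rest r r≢v t = trans (parentMatrix-reparent-other p v (p u) r≢v t) (sym (parentMatrix-reparent-other p v (just u) r≢v t))

  det-reparent-detach : ∀ {p v u} → Rooted p u → ¬ Ancestor p v u →
    det R (parentMatrix (reparent p v (just u))) ≈ det R (parentMatrix (reparent p v nothing))
  det-reparent-detach {p} {v} {u} rooted v∤u = begin
    det R (parentMatrix (reparent p v (just u)))  ≈⟨ det-reparent-climb (¬Ancestor⇒≢ v∤u) ⟨
    det R (parentMatrix (reparent p v (p u)))     ≈⟨ climb rooted ⟩
    det R (parentMatrix (reparent p v nothing))   ∎
    where
    via : ∀ {m} → p u ≡ m → det R (parentMatrix (reparent p v (p u))) ≈ det R (parentMatrix (reparent p v m))
    via pu≡m = det-cong (parentMatrix-cong (λ x → ≡.cong (λ m → reparent p v m x) pu≡m))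
    climb : Rooted p u → det R (parentMatrix (reparent p v (p u))) ≈ det R (parentMatrix (reparent p v nothing))
    climb (root pu≡∅)      = via pu≡∅
    climb (up pu≡y rooted) = trans (via pu≡y) (det-reparent-detach rooted (v∤u ∘ up pu≡y))

  det-parentMatrix-detach : ∀ {p} → Acyclic p → ∀ v → det R (parentMatrix p) ≈ det R (parentMatrix (reparent p v nothing))
  det-parentMatrix-detach {p} acyclic v =
    trans (det-cong (parentMatrix-cong (≡.sym ∘ reparent-self p v))) (clear (p v) ≡.refl)
    where
    clear : ∀ m → p v ≡ m → det R (parentMatrix (reparent p v m)) ≈ det R (parentMatrix (reparent p v nothing))
    clear nothing  _     = refl
    clear (just u) pv≡u = det-reparent-detach (acyclic u) (λ v∣u → no-cycle (acyclic u) v∣u pv≡u here)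

  det-parentMatrix-rootsOutside : ∀ vs {p} → Acyclic p → (∀ x → x ∉ˡ vs → p x ≡ nothing) →
                                  det R (parentMatrix p) ≈ 1#
  det-parentMatrix-rootsOutside [] {p} _ roots =
    det-identity (λ r t → parentMatrix-root p (roots r λ ()) t)
  det-parentMatrix-rootsOutside (v ∷ vs) {p} acyclic roots =
    trans (det-parentMatrix-detach acyclic v)
          (det-parentMatrix-rootsOutside vs (acyclic-reparent-root acyclic v) roots′)
    where
    roots′ : ∀ x → x ∉ˡ vs → reparent p v nothing x ≡ nothing
    roots′ x x∉vs with x ≟ v
    ... | yes _  = ≡.refl
    ... | no x≢v = roots x λ { (here x≡v) → x≢v x≡v ; (there x∈vs) → x∉vs x∈vs }

  det-parentMatrix : ∀ {p} → Acyclic p → det R (parentMatrix p) ≈ 1#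
  det-parentMatrix acyclic = det-parentMatrix-rootsOutside (allFin n) acyclic (λ x x∉ → ⊥-elim (x∉ (∈-allFin x)))

  unitRowDet : Fin n → Matrix R n → Fin n → Carrier
  unitRowDet i A x = det R (setRow A i (identity R x))

  unitRowDet-climb : ∀ i {p x y} → i ≢ x → p x ≡ just y →
                     unitRowDet i (parentMatrix p) x ≈ unitRowDet i (parentMatrix p) y
  unitRowDet-climb i {p} {x} {y} i≢x px≡y = det-add-row 1# i≢x rowᵢ rest
    where
    rowᵢ : ∀ t → setRow (parentMatrix p) i (identity R x) i t ≈
                 setRow (parentMatrix p) i (identity R y) i t + 1# * setRow (parentMatrix p) i (identity R y) x t
    rowᵢ t = begin
      setRow (parentMatrix p) i (identity R x) i t                   ≡⟨ setRow-same (parentMatrix p) i _ t ⟩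
      identity R x t                                                 ≈⟨ x≈y+1*[x-y] _ _ ⟩
      identity R y t + 1# * (identity R x t - identity R y t)        ≡⟨ ≡.cong₂ (λ a m → a + 1# * (identity R x t - parentRow m t))
                                                                          (≡.sym (setRow-same (parentMatrix p) i _ t)) (≡.sym px≡y) ⟩
      setRow (parentMatrix p) i (identity R y) i t + 1# * parentMatrix p x t
                                                                     ≡⟨ ≡.cong (λ a → _ + 1# * a) (setRow-other (parentMatrix p) i _ (i≢x ∘ ≡.sym) t) ⟨
      setRow (parentMatrix p) i (identity R y) i t + 1# * setRow (parentMatrix p) i (identity R y) x t ∎
    rest : RowsAgreeExcept i (setRow (parentMatrix p) i (identity R x)) (setRow (parentMatrix p) i (identity R y))
    rest r r≢i t =
      reflexive (≡.trans (setRow-other (parentMatrix p) i _ r≢i t) (≡.sym (setRow-other (parentMatrix p) i _ r≢i t)))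

  module _ {p : Parents} {i : Fin n} (pi≡∅ : p i ≡ nothing) where

    i≢child : ∀ {x y} → p x ≡ just y → i ≢ x
    i≢child px≡y ≡.refl = nothing≢just (≡.trans (≡.sym pi≡∅) px≡y)

    unitRowDet-ancestor : Acyclic p → ∀ {x} → Ancestor p i x → unitRowDet i (parentMatrix p) x ≈ 1#
    unitRowDet-ancestor acyclic here = trans (det-cong rows) (det-parentMatrix acyclic)
      where
      rows : ∀ r t → setRow (parentMatrix p) i (identity R i) r t ≈ parentMatrix p r t
      rows r t with r ≟ i
      ... | yes ≡.refl = sym (parentMatrix-root p pi≡∅ t)
      ... | no _       = refl
    unitRowDet-ancestor acyclic (up px≡y i∣y) =
      trans (unitRowDet-climb i {p} (i≢child px≡y) px≡y) (unitRowDet-ancestor acyclic i∣y)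

    unitRowDet-¬ancestor : ∀ {x} → Rooted p x → ¬ Ancestor p i x → unitRowDet i (parentMatrix p) x ≈ 0#
    unitRowDet-¬ancestor {x} (root px≡∅) i∤x = det-equal-rows _ (¬Ancestor⇒≢ i∤x ∘ ≡.sym) λ t → begin
      setRow (parentMatrix p) i (identity R x) i t  ≡⟨ setRow-same (parentMatrix p) i _ t ⟩
      identity R x t                                ≈⟨ parentMatrix-root p px≡∅ t ⟨
      parentMatrix p x t                            ≡⟨ setRow-other (parentMatrix p) i _ (¬Ancestor⇒≢ i∤x) t ⟨
      setRow (parentMatrix p) i (identity R x) x t  ∎
    unitRowDet-¬ancestor (up px≡y rooted) i∤x =
      trans (unitRowDet-climb i {p} (i≢child px≡y) px≡y) (unitRowDet-¬ancestor rooted (i∤x ∘ up px≡y))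

  -- The rows of v and of the vertices on the path from u up to v add up to the zero row.
  det-closes-cycle : ∀ {p} {M : Matrix R n} {v u} →
    (∀ {y z} → y ≢ v → p y ≡ just z → ∀ t → M y t ≈ identity R y t - identity R z t) →
    (∀ t → M v t ≈ identity R v t - identity R u t) → Ancestor p v u → det R M ≈ 0#
  det-closes-cycle {p} {M} {v} {u} parentRows rowᵥ v∣u = trans (det-cong M≈) (go v∣u)
    where
    M[_] : Fin n → Matrix R n
    M[ x ] = setRow M v (λ t → identity R v t - identity R x t)
    M≈ : ∀ r t → M r t ≈ M[ u ] r t
    M≈ r t with r ≟ v
    ... | yes ≡.refl = rowᵥ t
    ... | no _       = refl
    M[v]≈0 : det R M[ v ] ≈ 0#
    M[v]≈0 = det-zero-row v λ t → trans (reflexive (setRow-same M v _ t)) (-‿inverseʳ _)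
    go : ∀ {x} → Ancestor p v x → det R M[ x ] ≈ 0#
    go here = M[v]≈0
    go {x} (up {y = y} px≡y v∣y) with x ≟ v
    ... | yes ≡.refl = M[v]≈0
    ... | no x≢v     = trans (sym (det-add-row 1# (x≢v ∘ ≡.sym) rowᵥ′ rest)) (go v∣y)
      where
      rowᵥ′ : ∀ t → M[ y ] v t ≈ M[ x ] v t + 1# * M[ x ] x t
      rowᵥ′ t = begin
        M[ y ] v t                                          ≡⟨ setRow-same M v _ t ⟩
        identity R v t - identity R y t                     ≈⟨ x-z≈x-y+1*y-z _ (identity R x t) _ ⟩
        (identity R v t - identity R x t) + 1# * (identity R x t - identity R y t)
                                                            ≈⟨ +-cong (reflexive (≡.sym (setRow-same M v _ t)))
                                                                      (*-congˡ (trans (sym (parentRows x≢v px≡y t))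
                                                                                      (reflexive (≡.sym (setRow-other M v _ x≢v t))))) ⟩
        M[ x ] v t + 1# * M[ x ] x t                        ∎
      rest : RowsAgreeExcept v M[ y ] M[ x ]
      rest r r≢v t = reflexive (≡.trans (setRow-other M v _ r≢v t) (≡.sym (setRow-other M v _ r≢v t)))

module Arcs {a} {A : Set a} {n : ℕ} where

  along : (Γ : Multidigraph A n) → ∀ {m} → (Fin m → Fin (nArcs Γ)) → Multidigraph A n
  along Γ ι = record { nArcs = _ ; src = src Γ ∘ ι ; tgt = tgt Γ ∘ ι ; wt = wt Γ ∘ ι }

  graph : ∀ {m} → (Fin m → Fin n) → (Fin m → Fin n) → (Fin m → A) → Multidigraph A n
  graph s t w = record { nArcs = _ ; src = s ; tgt = t ; wt = w }

  chosenArcs : (Γ : Multidigraph A n) → (Fin (nArcs Γ) → Bool) → List (Fin n × Fin n)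
  chosenArcs Γ chosen = catMaybes (tabulate λ e → if chosen e then just (src Γ e , tgt Γ e) else nothing)

module SubsetSums {c ℓ} (R : CommutativeRing c ℓ) where
  open CommutativeRing R hiding (zero)
  open import Relation.Binary.Reasoning.Setoid setoid

  sumSubsets : ∀ m → (Subset m → Carrier) → Carrier
  sumSubsets zero    f = f []
  sumSubsets (suc m) f = sumSubsets m (f ∘ (false ∷_)) + sumSubsets m (f ∘ (true ∷_))

  sumSubsets-cong : ∀ m {f g : Subset m → Carrier} → (∀ S → f S ≈ g S) → sumSubsets m f ≈ sumSubsets m g
  sumSubsets-cong zero    f≈g = f≈g []
  sumSubsets-cong (suc m) f≈g = +-cong (sumSubsets-cong m (f≈g ∘ (false ∷_))) (sumSubsets-cong m (f≈g ∘ (true ∷_)))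

  sumSubsets-zero : ∀ m {f : Subset m → Carrier} → (∀ S → f S ≈ 0#) → sumSubsets m f ≈ 0#
  sumSubsets-zero zero    f≈0 = f≈0 []
  sumSubsets-zero (suc m) f≈0 =
    trans (+-cong (sumSubsets-zero m (f≈0 ∘ (false ∷_))) (sumSubsets-zero m (f≈0 ∘ (true ∷_)))) (+-identityʳ 0#)

  sumSubsets-distrib-+ : ∀ m (f g : Subset m → Carrier) → sumSubsets m (λ S → f S + g S) ≈ sumSubsets m f + sumSubsets m g
  sumSubsets-distrib-+ zero    f g = refl
  sumSubsets-distrib-+ (suc m) f g =
    trans (+-cong (sumSubsets-distrib-+ m _ _) (sumSubsets-distrib-+ m _ _))
          (solve 4 (λ a b c d → (a :+ b) :+ (c :+ d) := (a :+ c) :+ (b :+ d)) refl _ _ _ _)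
    where open RingFacts R using (solve; _:+_; _:=_)

  *-distribˡ-sumSubsets : ∀ m x (f : Subset m → Carrier) → x * sumSubsets m f ≈ sumSubsets m (λ S → x * f S)
  *-distribˡ-sumSubsets zero    x f = refl
  *-distribˡ-sumSubsets (suc m) x f = trans (distribˡ x _ _) (+-cong (*-distribˡ-sumSubsets m x _) (*-distribˡ-sumSubsets m x _))

  sumSubsets-single : ∀ m (S₀ : Subset m) {f : Subset m → Carrier} → (∀ S → S ≢ S₀ → f S ≈ 0#) →
                      sumSubsets m f ≈ f S₀
  sumSubsets-single zero    []          f≈0 = refl
  sumSubsets-single (suc m) (false ∷ S₀) f≈0 =
    trans (+-cong (sumSubsets-single m S₀ λ S S≢S₀ → f≈0 (false ∷ S) (S≢S₀ ∘ ∷-injectiveʳ))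
                  (sumSubsets-zero m λ S → f≈0 (true ∷ S) λ ()))
          (+-identityʳ _)
  sumSubsets-single (suc m) (true ∷ S₀)  f≈0 =
    trans (+-cong (sumSubsets-zero m λ S → f≈0 (false ∷ S) λ ())
                  (sumSubsets-single m S₀ λ S S≢S₀ → f≈0 (true ∷ S) (S≢S₀ ∘ ∷-injectiveʳ)))
          (+-identityˡ _)

  _≟ˢ_ : ∀ {m} → DecidableEquality (Subset m)
  _≟ˢ_ = ≡-dec _≟ᵇ_

  _∈ˡ?_ : ∀ {m} (S : Subset m) Fs → Dec (S ∈ˡ Fs)
  S ∈ˡ? Fs = any? (S ≟ˢ_) Fs

  sumList≈sumSubsets : ∀ {m} (f : Subset m → Carrier) Fs → Unique Fs →
                       sumList R (map f Fs) ≈ sumSubsets m (λ S → if does (S ∈ˡ? Fs) then f S else 0#)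
  sumList≈sumSubsets {m} f []       []           = sym (sumSubsets-zero m λ _ → refl)
  sumList≈sumSubsets {m} f (x ∷ xs) (x∉xs ∷ uniq) = begin
    f x + sumList R (map f xs)
      ≈⟨ +-cong (sym (trans (sumSubsets-single m x onlyX) atX)) (sumList≈sumSubsets f xs uniq) ⟩
    sumSubsets m (λ S → if does (S ≟ˢ x) then f S else 0#) + sumSubsets m (λ S → if does (S ∈ˡ? xs) then f S else 0#)
      ≈⟨ sumSubsets-distrib-+ m _ _ ⟨
    sumSubsets m (λ S → (if does (S ≟ˢ x) then f S else 0#) + (if does (S ∈ˡ? xs) then f S else 0#))
      ≈⟨ sumSubsets-cong m split ⟩
    sumSubsets m (λ S → if does (S ∈ˡ? (x ∷ xs)) then f S else 0#) ∎
    where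
    atX : (if does (x ≟ˢ x) then f x else 0#) ≈ f x
    atX with x ≟ˢ x
    ... | yes _  = refl
    ... | no x≢x = ⊥-elim (x≢x ≡.refl)
    onlyX : ∀ S → S ≢ x → (if does (S ≟ˢ x) then f S else 0#) ≈ 0#
    onlyX S S≢x with S ≟ˢ x
    ... | yes S≡x = ⊥-elim (S≢x S≡x)
    ... | no _    = refl
    split : ∀ S → (if does (S ≟ˢ x) then f S else 0#) + (if does (S ∈ˡ? xs) then f S else 0#) ≈
                  (if does (S ∈ˡ? (x ∷ xs)) then f S else 0#)
    split S with S ≟ˢ x | S ∈ˡ? xs | S ∈ˡ? (x ∷ xs)
    ... | yes ≡.refl | yes S∈xs | _              = ⊥-elim (All.lookup x∉xs S∈xs ≡.refl)
    ... | yes _      | no _     | yes _          = +-identityʳ _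
    ... | yes S≡x    | no _     | no S∉          = ⊥-elim (S∉ (here S≡x))
    ... | no _       | yes _    | yes _          = +-identityˡ _
    ... | no _       | yes S∈xs | no S∉          = ⊥-elim (S∉ (there S∈xs))
    ... | no S≢x     | no _     | yes (here S≡x) = ⊥-elim (S≢x S≡x)
    ... | no _       | no S∉xs  | yes (there S∈xs) = ⊥-elim (S∉xs S∈xs)
    ... | no _       | no _     | no _           = +-identityʳ 0#

module ArcMatrices {c ℓ} (R : CommutativeRing c ℓ) {n : ℕ} where
  open CommutativeRing R hiding (zero)
  open RingFacts R
  open ParentMaps n
  open ParentMatrices R n
  open import Relation.Binary.Reasoning.Setoid setoid

  arcRow : Multidigraph Carrier n → Fin n → Fin n → Carrier
  arcRow Γ r t = Σᶠ R λ e → if does (tgt Γ e ≟ r) then wt Γ e * (identity R r t - identity R (src Γ e) t) else 0#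

  isRoot : Maybe (Fin n) → Carrier
  isRoot nothing  = 1#
  isRoot (just _) = 0#

  -- The row of a vertex r with a parent u is e_r − e_u; the row of a root r is e_r plus
  -- the Kirchhoff row of r in Γ.
  arcMatrix : Multidigraph Carrier n → Parents → Matrix R n
  arcMatrix Γ p r t = parentMatrix p r t + isRoot (p r) * arcRow Γ r t

  arcMatrix-child : ∀ Γ p r {z} → p r ≡ just z → ∀ t → arcMatrix Γ p r t ≈ identity R r t - identity R z t
  arcMatrix-child Γ p r {z} pr≡z t = begin
    parentMatrix p r t + isRoot (p r) * arcRow Γ r t
      ≡⟨ ≡.cong (λ m → identity R r t - parentRow m t + isRoot m * arcRow Γ r t) pr≡z ⟩
    identity R r t - identity R z t + 0# * arcRow Γ r t
      ≈⟨ trans (+-congˡ (zeroˡ _)) (+-identityʳ _) ⟩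
    identity R r t - identity R z t ∎

module ArcExpansion {c ℓ} (R : CommutativeRing c ℓ) {n : ℕ} (i j : Fin n) where
  open CommutativeRing R hiding (zero)
  open RingFacts R
  open FinSums R
  open Determinants R
  open ParentMaps n
  open ParentMatrices R n
  open SubsetSums R
  open ArcMatrices R
  open ForestScan n i j
  open Arcs
  open import Relation.Binary.Reasoning.Setoid setoid

  unitRowDet-cong : ∀ {A B : Matrix R n} x → RowsAgreeExcept i A B → unitRowDet i A x ≈ unitRowDet i B x
  unitRowDet-cong {A} {B} x A~B = det-cong rows
    where
    rows : ∀ r t → setRow A i (identity R x) r t ≈ setRow B i (identity R x) r t
    rows r t with r ≟ i
    ... | yes _  = refl
    ... | no r≢i = A~B r r≢i t

  unitRowDet-cycle : ∀ Γ {p v u} → p i ≡ nothing → v ≢ i → Ancestor p v u → ∀ x →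
                     unitRowDet i (arcMatrix Γ (reparent p v (just u))) x ≈ 0#
  unitRowDet-cycle Γ {p} {v} {u} pi≡∅ v≢i v∣u x = det-closes-cycle parentRows rowᵥ v∣u
    where
    p′ = reparent p v (just u)
    M = setRow (arcMatrix Γ p′) i (identity R x)
    parentRows : ∀ {y z} → y ≢ v → p y ≡ just z → ∀ t → M y t ≈ identity R y t - identity R z t
    parentRows {y} y≢v py≡z t = trans (reflexive (setRow-other (arcMatrix Γ p′) i _ {y} (i≢child pi≡∅ py≡z ∘ ≡.sym) t))
                                      (arcMatrix-child Γ p′ y (≡.trans (reparent-other p v _ y≢v) py≡z) t)
    rowᵥ : ∀ t → M v t ≈ identity R v t - identity R u t
    rowᵥ t = trans (reflexive (setRow-other (arcMatrix Γ p′) i _ v≢i t)) (arcMatrix-child Γ p′ v (reparent-same p v _) t)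

  module FirstArc {m} (s t : Fin (suc m) → Fin n) (w : Fin (suc m) → Carrier) where
    Γ  = graph s t w
    Γ′ = along Γ suc
    u  = s zero
    v  = t zero

    firstTerm : Fin n → Fin n → Carrier
    firstTerm r x = if does (v ≟ r) then w zero * (identity R r x - identity R u x) else 0#

    arcMatrix-split : ∀ p r x → arcMatrix Γ p r x ≈ arcMatrix Γ′ p r x + isRoot (p r) * firstTerm r x
    arcMatrix-split p r x = solve 4 (λ a b f g → a :+ b :* (f :+ g) := (a :+ b :* g) :+ b :* f) refl
                              (parentMatrix p r x) (isRoot (p r)) (firstTerm r x) (arcRow Γ′ r x)

    arcMatrix-otherRow : ∀ p {r} → v ≢ r → ∀ x → arcMatrix Γ p r x ≈ arcMatrix Γ′ p r x
    arcMatrix-otherRow p {r} v≢r x =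
      trans (arcMatrix-split p r x) (trans (+-congˡ (trans (*-congˡ first≈0) (zeroʳ _))) (+-identityʳ _))
      where
      first≈0 : firstTerm r x ≈ 0#
      first≈0 with v ≟ r
      ... | yes v≡r = ⊥-elim (v≢r v≡r)
      ... | no _    = refl

    arcMatrix-hasParent : ∀ p {y} → p v ≡ just y → ∀ r x → arcMatrix Γ p r x ≈ arcMatrix Γ′ p r x
    arcMatrix-hasParent p pv≡y r x = byCases (v ≟ r)
      where
      byCases : Dec (v ≡ r) → arcMatrix Γ p r x ≈ arcMatrix Γ′ p r x
      byCases (no v≢r)     = arcMatrix-otherRow p v≢r x
      byCases (yes ≡.refl) = trans (arcMatrix-split p v x)
        (trans (+-congˡ (trans (*-congʳ (reflexive (≡.cong isRoot pv≡y))) (zeroˡ _))) (+-identityʳ _))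

    unitRowDet-split : ∀ p → p v ≡ nothing → v ≢ i →
      unitRowDet i (arcMatrix Γ p) j ≈
      unitRowDet i (arcMatrix Γ′ p) j + w zero * unitRowDet i (arcMatrix Γ′ (reparent p v (just u))) j
    unitRowDet-split p pv≡∅ v≢i = det-linear v (w zero) agree agree′ rowᵥ
      where
      p′ = reparent p v (just u)
      X = setRow (arcMatrix Γ p) i (identity R j)
      agree : RowsAgreeExcept v X (setRow (arcMatrix Γ′ p) i (identity R j))
      agree r r≢v x with r ≟ i
      ... | yes _ = refl
      ... | no _  = arcMatrix-otherRow p (r≢v ∘ ≡.sym) x
      agree′ : RowsAgreeExcept v X (setRow (arcMatrix Γ′ p′) i (identity R j))
      agree′ r r≢v x with r ≟ i
      ... | yes _ = refl
      ... | no _  = trans (arcMatrix-otherRow p (r≢v ∘ ≡.sym) x)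
                          (reflexive (≡.cong (λ m → identity R r x - parentRow m x + isRoot m * arcRow Γ′ r x)
                                             (≡.sym (reparent-other p v _ r≢v))))
      rowᵥ : ∀ x → X v x ≈
                   setRow (arcMatrix Γ′ p) i (identity R j) v x + w zero * setRow (arcMatrix Γ′ p′) i (identity R j) v x
      rowᵥ x = begin
        X v x                                                          ≡⟨ setRow-other (arcMatrix Γ p) i _ v≢i x ⟩
        arcMatrix Γ p v x                                              ≈⟨ arcMatrix-split p v x ⟩
        arcMatrix Γ′ p v x + isRoot (p v) * firstTerm v x              ≈⟨ +-congˡ (*-cong (reflexive (≡.cong isRoot pv≡∅)) first) ⟩
        arcMatrix Γ′ p v x + 1# * (w zero * (identity R v x - identity R u x))
                                                                       ≈⟨ +-cong (reflexive (≡.sym (setRow-other (arcMatrix Γ′ p) i _ v≢i x)))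
                                                                                 (trans (*-identityˡ _) (*-congˡ (sym parentRow′))) ⟩
        setRow (arcMatrix Γ′ p) i (identity R j) v x + w zero * setRow (arcMatrix Γ′ p′) i (identity R j) v x ∎
        where
        first : firstTerm v x ≈ w zero * (identity R v x - identity R u x)
        first with v ≟ v
        ... | yes _  = refl
        ... | no v≢v = ⊥-elim (v≢v ≡.refl)
        parentRow′ : setRow (arcMatrix Γ′ p′) i (identity R j) v x ≈ identity R v x - identity R u x
        parentRow′ = trans (reflexive (setRow-other (arcMatrix Γ′ p′) i _ v≢i x))
                           (arcMatrix-child Γ′ p′ v (reparent-same p v _) x)

  forestSum : (Γ : Multidigraph Carrier n) (p : Parents) → Acyclic p → Carrier
  forestSum Γ p acyclic =
    sumSubsets (nArcs Γ) λ S → if acceptsArcs p acyclic (chosenArcs Γ (lookup S)) then ε R Γ S else 0#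

  module _ {m} (s t : Fin (suc m) → Fin n) (w : Fin (suc m) → Carrier) where
    open FirstArc s t w

    -- the right-hand side is forestSum Γ p acyclic unfolded, when the first arc is rejected
    forestSum-unchosen : ∀ {p} (acyclic : Acyclic p) → forestSum Γ′ p acyclic ≈
      sumSubsets m (λ S → if acceptsArcs p acyclic (chosenArcs Γ′ (lookup S)) then 1# * ε R Γ′ S else 0#) +
      sumSubsets m (λ _ → 0#)
    forestSum-unchosen {p} acyclic = sym (trans (+-congˡ (sumSubsets-zero m λ _ → refl))
      (trans (+-identityʳ _) (sumSubsets-cong m λ S →
        trans (if-distribˡ (acceptsArcs p acyclic (chosenArcs Γ′ (lookup S))) 1# _) (*-identityˡ _))))

    -- the right-hand side is forestSum Γ p acyclic unfolded, when the first arc is accepted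
    forestSum-chosen : ∀ {p p′} (acyclic : Acyclic p) (acyclic′ : Acyclic p′) →
      forestSum Γ′ p acyclic + w zero * forestSum Γ′ p′ acyclic′ ≈
      sumSubsets m (λ S → if acceptsArcs p acyclic (chosenArcs Γ′ (lookup S)) then 1# * ε R Γ′ S else 0#) +
      sumSubsets m (λ S → if acceptsArcs p′ acyclic′ (chosenArcs Γ′ (lookup S)) then w zero * ε R Γ′ S else 0#)
    forestSum-chosen {p} {p′} acyclic acyclic′ = +-cong
      (sumSubsets-cong m λ S →
        trans (sym (*-identityˡ _)) (sym (if-distribˡ (acceptsArcs p acyclic (chosenArcs Γ′ (lookup S))) 1# _)))
      (trans (*-distribˡ-sumSubsets m (w zero) _)
             (sumSubsets-cong m λ S → sym (if-distribˡ (acceptsArcs p′ acyclic′ (chosenArcs Γ′ (lookup S))) (w zero) _)))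

  unitRowDet≈forestSum′ : ∀ {m} (s t : Fin m → Fin n) (w : Fin m → Carrier) {p} (acyclic : Acyclic p) → p i ≡ nothing →
              unitRowDet i (arcMatrix (graph s t w) p) j ≈ forestSum (graph s t w) p acyclic
  unitRowDet≈forestSum′ {zero} s t w {p} acyclic pi≡∅ =
    trans (unitRowDet-cong j λ r _ x → trans (+-congˡ (zeroʳ _)) (+-identityʳ _)) (evaluate (ancestor? p i (acyclic j)))
    where
    evaluate : (i∣j? : Dec (Ancestor p i j)) → unitRowDet i (parentMatrix p) j ≈ (if does i∣j? then 1# else 0#)
    evaluate (yes i∣j) = unitRowDet-ancestor pi≡∅ acyclic i∣j
    evaluate (no i∤j)  = unitRowDet-¬ancestor pi≡∅ (acyclic j) i∤j
  unitRowDet≈forestSum′ {suc m} s t w {p} acyclic pi≡∅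
    with p (t zero) in pv≡ | t zero ≟ i | ancestor? p (t zero) (acyclic (s zero))
  ... | just _  | _       | _       =
    trans (unitRowDet-cong j λ r _ → arcMatrix-hasParent p pv≡ r)
          (trans (unitRowDet≈forestSum′ (s ∘ suc) (t ∘ suc) (w ∘ suc) acyclic pi≡∅) (forestSum-unchosen s t w acyclic))
    where open FirstArc s t w
  ... | nothing | yes v≡i | _       =
    trans (unitRowDet-cong j λ r r≢i → arcMatrix-otherRow p λ v≡r → r≢i (≡.trans (≡.sym v≡r) v≡i))
          (trans (unitRowDet≈forestSum′ (s ∘ suc) (t ∘ suc) (w ∘ suc) acyclic pi≡∅) (forestSum-unchosen s t w acyclic))
    where open FirstArc s t w
  ... | nothing | no v≢i  | yes v∣u = begin
    unitRowDet i (arcMatrix Γ p) j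
      ≈⟨ unitRowDet-split p pv≡ v≢i ⟩
    unitRowDet i (arcMatrix Γ′ p) j + w zero * unitRowDet i (arcMatrix Γ′ (reparent p v (just u))) j
      ≈⟨ +-congˡ (trans (*-congˡ (unitRowDet-cycle Γ′ pi≡∅ v≢i v∣u j)) (zeroʳ _)) ⟩
    unitRowDet i (arcMatrix Γ′ p) j + 0#
      ≈⟨ +-identityʳ _ ⟩
    unitRowDet i (arcMatrix Γ′ p) j
      ≈⟨ trans (unitRowDet≈forestSum′ (s ∘ suc) (t ∘ suc) (w ∘ suc) acyclic pi≡∅) (forestSum-unchosen s t w acyclic) ⟩
    _ ∎
    where open FirstArc s t w
  ... | nothing | no v≢i  | no v∤u  = begin
    unitRowDet i (arcMatrix Γ p) j
      ≈⟨ unitRowDet-split p pv≡ v≢i ⟩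
    unitRowDet i (arcMatrix Γ′ p) j + w zero * unitRowDet i (arcMatrix Γ′ p′) j
      ≈⟨ +-cong (unitRowDet≈forestSum′ (s ∘ suc) (t ∘ suc) (w ∘ suc) acyclic pi≡∅)
                (*-congˡ (unitRowDet≈forestSum′ (s ∘ suc) (t ∘ suc) (w ∘ suc) acyclic′ p′i≡∅)) ⟩
    forestSum Γ′ p acyclic + w zero * forestSum Γ′ p′ acyclic′
      ≈⟨ forestSum-chosen s t w acyclic acyclic′ ⟩
    _ ∎
    where
    open FirstArc s t w
    p′ = reparent p v (just u)
    acyclic′ = acyclic-reparent acyclic v∤u
    p′i≡∅ = ≡.trans (reparent-other p v _ (v≢i ∘ ≡.sym)) pi≡∅

  unitRowDet≈forestSum : ∀ Γ {p} (acyclic : Acyclic p) → p i ≡ nothing →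
                         unitRowDet i (arcMatrix Γ p) j ≈ forestSum Γ p acyclic
  unitRowDet≈forestSum Γ = unitRowDet≈forestSum′ (src Γ) (tgt Γ) (wt Γ)

module KirchhoffRows {c ℓ} (R : CommutativeRing c ℓ) {n : ℕ} (Γ : Multidigraph (CommutativeRing.Carrier R) n) where
  open CommutativeRing R hiding (zero)
  open RingFacts R
  open FinSums R
  open ArcMatrices R
  open import Relation.Binary.Reasoning.Setoid setoid

  into : Fin (nArcs Γ) → Fin n → Carrier
  into e r = if does (tgt Γ e ≟ r) then wt Γ e else 0#

  arcSum≈ : ∀ t r → arcSum R Γ t r ≈ Σᶠ R (λ e → identity R (src Γ e) t * into e r)
  arcSum≈ t r = Σᶠ-cong pointwise
    where
    pointwise : ∀ e → (if does (src Γ e ≟ t) then into e r else 0#) ≈ identity R (src Γ e) t * into e r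
    pointwise e with src Γ e ≟ t
    ... | yes _ = sym (*-identityˡ _)
    ... | no _  = sym (zeroˡ _)

  arcRow≈ : ∀ r t → arcRow Γ r t ≈ Σᶠ R (λ e → into e r * (identity R r t - identity R (src Γ e) t))
  arcRow≈ r t = Σᶠ-cong pointwise
    where
    pointwise : ∀ e → (if does (tgt Γ e ≟ r) then wt Γ e * (identity R r t - identity R (src Γ e) t) else 0#) ≈
                      into e r * (identity R r t - identity R (src Γ e) t)
    pointwise e with tgt Γ e ≟ r
    ... | yes _ = refl
    ... | no _  = sym (zeroˡ _)

  kirchhoff-offDiag : ∀ {r t} → r ≢ t → kirchhoff R Γ r t ≈ arcRow Γ r t
  kirchhoff-offDiag {r} {t} r≢t = begin
    kirchhoff R Γ r t                                      ≡⟨ unfold ⟩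
    - arcSum R Γ t r                                       ≈⟨ -‿cong (arcSum≈ t r) ⟩
    - Σᶠ R (λ e → identity R (src Γ e) t * into e r)       ≈⟨ -‿distrib-Σᶠ (λ e → identity R (src Γ e) t * into e r) ⟩
    Σᶠ R (λ e → - (identity R (src Γ e) t * into e r))     ≈⟨ Σᶠ-cong pointwise ⟩
    Σᶠ R (λ e → into e r * (identity R r t - identity R (src Γ e) t)) ≈⟨ arcRow≈ r t ⟨
    arcRow Γ r t                                           ∎
    where
    unfold : kirchhoff R Γ r t ≡ - arcSum R Γ t r
    unfold with r ≟ t
    ... | yes r≡t = ⊥-elim (r≢t r≡t)
    ... | no _    = ≡.refl
    pointwise : ∀ e → - (identity R (src Γ e) t * into e r) ≈ into e r * (identity R r t - identity R (src Γ e) t)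
    pointwise e = begin
      - (identity R (src Γ e) t * into e r)          ≈⟨ -‿cong (*-comm _ _) ⟩
      - (into e r * identity R (src Γ e) t)          ≈⟨ -‿distribʳ-* _ _ ⟩
      into e r * - identity R (src Γ e) t            ≈⟨ *-congˡ (+-identityˡ _) ⟨
      into e r * (0# - identity R (src Γ e) t)       ≈⟨ *-congˡ (+-congʳ (identity-off r≢t)) ⟨
      into e r * (identity R r t - identity R (src Γ e) t) ∎

  kirchhoff-diag : ∀ r → kirchhoff R Γ r r ≈ arcRow Γ r r
  kirchhoff-diag r = begin
    kirchhoff R Γ r r
      ≡⟨ unfold ⟩
    - Σᶠ R (offDiag R Γ r)
      ≈⟨ -‿distrib-Σᶠ (offDiag R Γ r) ⟩
    Σᶠ R (λ k → - offDiag R Γ r k)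
      ≈⟨ Σᶠ-cong (λ k → trans (negOffDiag k) (*-congˡ (arcSum≈ k r))) ⟩
    Σᶠ R (λ k → (1# - identity R r k) * Σᶠ R (λ e → identity R (src Γ e) k * into e r))
      ≈⟨ Σᶠ-cong (λ k → trans (*-distribˡ-Σᶠ (1# - identity R r k) (λ e → identity R (src Γ e) k * into e r))
                              (Σᶠ-cong λ e → x*[y*z]≈y*[x*z] (1# - identity R r k) (identity R (src Γ e) k) (into e r))) ⟩
    Σᶠ R (λ k → Σᶠ R (λ e → identity R (src Γ e) k * ((1# - identity R r k) * into e r)))
      ≈⟨ Σᶠ-comm (λ k e → identity R (src Γ e) k * ((1# - identity R r k) * into e r)) ⟩
    Σᶠ R (λ e → Σᶠ R (λ k → identity R (src Γ e) k * ((1# - identity R r k) * into e r)))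
      ≈⟨ Σᶠ-cong (λ e → Σᶠ-select (src Γ e) (λ k → (1# - identity R r k) * into e r)) ⟩
    Σᶠ R (λ e → (1# - identity R r (src Γ e)) * into e r)
      ≈⟨ Σᶠ-cong (λ e → trans (*-comm _ _) (*-congˡ (+-cong (sym (identity-diag r)) (-‿cong (identity-sym r (src Γ e)))))) ⟩
    Σᶠ R (λ e → into e r * (identity R r r - identity R (src Γ e) r))
      ≈⟨ arcRow≈ r r ⟨
    arcRow Γ r r ∎
    where
    unfold : kirchhoff R Γ r r ≡ - Σᶠ R (offDiag R Γ r)
    unfold with r ≟ r
    ... | yes _  = ≡.refl
    ... | no r≢r = ⊥-elim (r≢r ≡.refl)
    negOffDiag : ∀ k → - offDiag R Γ r k ≈ (1# - identity R r k) * arcSum R Γ k r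
    negOffDiag k with r ≟ k
    ... | yes _ = trans -0#≈0# (sym (trans (*-congʳ (-‿inverseʳ 1#)) (zeroˡ _)))
    ... | no _  = trans (-‿involutive _) (sym (trans (*-congʳ (x-0≈x 1#)) (*-identityˡ _)))
    x*[y*z]≈y*[x*z] : ∀ x y z → x * (y * z) ≈ y * (x * z)
    x*[y*z]≈y*[x*z] = solve 3 (λ x y z → x :* (y :* z) := y :* (x :* z)) refl

  kirchhoff≈arcRow : ∀ r t → kirchhoff R Γ r t ≈ arcRow Γ r t
  kirchhoff≈arcRow r t = byCases (r ≟ t)
    where
    byCases : Dec (r ≡ t) → kirchhoff R Γ r t ≈ arcRow Γ r t
    byCases (yes ≡.refl) = kirchhoff-diag r
    byCases (no r≢t)     = kirchhoff-offDiag r≢t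

  W≈arcMatrix : ∀ r t → Wmat R Γ r t ≈ arcMatrix Γ (ParentMaps.noParents n) r t
  W≈arcMatrix r t = +-cong (sym (x-0≈x _)) (trans (kirchhoff≈arcRow r t) (sym (*-identityˡ _)))

does≡true⇔ : ∀ {p} {P : Set p} (P? : Dec P) → does P? ≡ true ⇔ P
does≡true⇔ (yes p) = mk⇔ (λ _ → p) (λ _ → ≡.refl)
does≡true⇔ (no ¬p) = mk⇔ (λ ()) (⊥-elim ∘ ¬p)

module Walks {a} {A : Set a} {n : ℕ} (Γ : Multidigraph A n) (S : Subset (nArcs Γ)) where

  Arc : Set
  Arc = Fin (nArcs Γ)

  Walk : Fin n → Fin n → List Arc → Set
  Walk = UWalk Γ S

  _++ʷ_ : ∀ {x y z es fs} → Walk x y es → Walk y z fs → Walk x z (es ++ fs)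
  nil            ++ʷ w′ = w′
  fwd e e∈S s≡ w ++ʷ w′ = fwd e e∈S s≡ (w ++ʷ w′)
  bwd e e∈S t≡ w ++ʷ w′ = bwd e e∈S t≡ (w ++ʷ w′)

  nil≡ : ∀ {x y} → x ≡ y → Walk x y []
  nil≡ ≡.refl = nil

  reverse : ∀ {x y es} → Walk x y es → Σ[ es′ ∈ List Arc ] (Walk y x es′ × es′ ⊆ es)
  reverse nil = [] , nil , λ ()
  reverse (fwd e e∈S s≡x w) with reverse w
  ... | es′ , w′ , es′⊆ = es′ ++ e ∷ [] , w′ ++ʷ bwd e e∈S ≡.refl (nil≡ s≡x) , ⊆e∷
    where
    ⊆e∷ : (es′ ++ e ∷ []) ⊆ (e ∷ _)
    ⊆e∷ e′∈ with ∈-++⁻ es′ e′∈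
    ... | inj₁ e′∈es′       = there (es′⊆ e′∈es′)
    ... | inj₂ (here ≡.refl) = here ≡.refl
  reverse (bwd e e∈S t≡x w) with reverse w
  ... | es′ , w′ , es′⊆ = es′ ++ e ∷ [] , w′ ++ʷ fwd e e∈S ≡.refl (nil≡ t≡x) , ⊆e∷
    where
    ⊆e∷ : (es′ ++ e ∷ []) ⊆ (e ∷ _)
    ⊆e∷ e′∈ with ∈-++⁻ es′ e′∈
    ... | inj₁ e′∈es′       = there (es′⊆ e′∈es′)
    ... | inj₂ (here ≡.refl) = here ≡.refl

  Avoids : Fin n → Fin n → List Arc → Set
  Avoids v x es = x ≢ v × All (λ e → src Γ e ≢ v × tgt Γ e ≢ v) es

  suffixFrom : ∀ {x y es} → Walk x y es → ∀ v →
               (Σ[ pre ∈ List Arc ] Σ[ fs ∈ List Arc ] (es ≡ pre ++ fs × Walk v y fs)) ⊎ Avoids v x es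
  suffixFrom {x} nil v with x ≟ v
  ... | yes ≡.refl = inj₁ ([] , [] , ≡.refl , nil)
  ... | no x≢v     = inj₂ (x≢v , [])
  suffixFrom {x} (fwd e e∈S s≡x w) v with x ≟ v
  ... | yes ≡.refl = inj₁ ([] , _ , ≡.refl , fwd e e∈S s≡x w)
  ... | no x≢v with suffixFrom w v
  ...   | inj₁ (pre , fs , ≡.refl , w′) = inj₁ (e ∷ pre , fs , ≡.refl , w′)
  ...   | inj₂ (t≢v , avoids)          = inj₂ (x≢v , ((x≢v ∘ ≡.trans (≡.sym s≡x)) , t≢v) ∷ avoids)
  suffixFrom {x} (bwd e e∈S t≡x w) v with x ≟ v
  ... | yes ≡.refl = inj₁ ([] , _ , ≡.refl , bwd e e∈S t≡x w)
  ... | no x≢v with suffixFrom w v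
  ...   | inj₁ (pre , fs , ≡.refl , w′) = inj₁ (e ∷ pre , fs , ≡.refl , w′)
  ...   | inj₂ (s≢v , avoids)          = inj₂ (x≢v , (s≢v , (x≢v ∘ ≡.trans (≡.sym t≡x))) ∷ avoids)

  Unique-++ʳ : ∀ (pre : List Arc) {fs} → Unique (pre ++ fs) → Unique fs
  Unique-++ʳ []        uniq       = uniq
  Unique-++ʳ (_ ∷ pre) (_ ∷ uniq) = Unique-++ʳ pre uniq

  -- cuts out the closed detours
  toTrail : ∀ {x y es} → Walk x y es → Σ[ es′ ∈ List Arc ] (Walk x y es′ × Unique es′ × es′ ⊆ es)
  toTrail nil = [] , nil , [] , λ ()
  toTrail {x} (fwd e e∈S s≡x w) with toTrail w
  ... | es′ , w′ , uniq , es′⊆ with suffixFrom w′ x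
  ...   | inj₁ (pre , fs , ≡.refl , w″) = fs , w″ , Unique-++ʳ pre uniq , there ∘ es′⊆ ∘ ∈-++⁺ʳ pre
  ...   | inj₂ (_ , avoids) =
    e ∷ es′ , fwd e e∈S s≡x w′ ,
    All.map (λ { (s≢x , _) ≡.refl → s≢x s≡x }) avoids ∷ uniq ,
    λ { (here ≡.refl) → here ≡.refl ; (there e′∈) → there (es′⊆ e′∈) }
  toTrail {x} (bwd e e∈S t≡x w) with toTrail w
  ... | es′ , w′ , uniq , es′⊆ with suffixFrom w′ x
  ...   | inj₁ (pre , fs , ≡.refl , w″) = fs , w″ , Unique-++ʳ pre uniq , there ∘ es′⊆ ∘ ∈-++⁺ʳ pre
  ...   | inj₂ (_ , avoids) =
    e ∷ es′ , bwd e e∈S t≡x w′ ,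
    All.map (λ { (_ , t≢x) ≡.refl → t≢x t≡x }) avoids ∷ uniq ,
    λ { (here ≡.refl) → here ≡.refl ; (there e′∈) → there (es′⊆ e′∈) }

  forest-arc-isBridge : IsDirectedForest Γ S → ∀ {e es} → e ∈ₛ S → Walk (tgt Γ e) (src Γ e) es → e ∉ˡ es → ⊥
  forest-arc-isBridge forest {e} e∈S w e∉es with toTrail w
  ... | es′ , w′ , uniq , es′⊆ with forest (src Γ e) (e ∷ es′) (fwd e e∈S ≡.refl w′)
                                     (All.tabulate (λ e′∈ e≡e′ → e∉es (es′⊆ (≡.subst (_∈ˡ es′) (≡.sym e≡e′) e′∈)))
                                      ∷ uniq)
  ... | ()

  reach⇒walk : ∀ {u v} → Reach Γ S u v → Σ[ es ∈ List Arc ] Walk u v es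
  reach⇒walk here = [] , nil
  reach⇒walk (step e e∈S s≡u r) = let es , w = reach⇒walk r in e ∷ es , fwd e e∈S s≡u w

  reach-snoc : ∀ {u y} → Reach Γ S u y → ∀ e → e ∈ₛ S → src Γ e ≡ y → Reach Γ S u (tgt Γ e)
  reach-snoc here               e e∈S s≡y = step e e∈S s≡y here
  reach-snoc (step e′ e′∈S s≡ r) e e∈S s≡y = step e′ e′∈S s≡ (reach-snoc r e e∈S s≡y)

  NoArcInto : Fin n → List Arc → Set
  NoArcInto v = All (λ e → tgt Γ e ≢ v)

  -- split a directed walk after its last arc into v
  lastEntry : ∀ {u y} → Reach Γ S u y → ∀ v →
    (Σ[ es ∈ List Arc ] (Walk u y es × NoArcInto v es)) ⊎ (Σ[ es ∈ List Arc ] (Walk v y es × NoArcInto v es))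
  lastEntry here v = inj₁ ([] , nil , [])
  lastEntry (step e e∈S s≡u r) v with lastEntry r v
  ... | inj₂ suffix = inj₂ suffix
  ... | inj₁ (es , w , noEntry) with tgt Γ e ≟ v
  ...   | yes ≡.refl = inj₂ (es , w , noEntry)
  ...   | no t≢v     = inj₁ (e ∷ es , fwd e e∈S s≡u w , t≢v ∷ noEntry)

module ParentForests {a} {A : Set a} {n : ℕ} (Γ : Multidigraph A n) (S : Subset (nArcs Γ)) where
  open ParentMaps n
  open Walks Γ S

  record IsParentMapOf (P : Parents) : Set where
    field
      acyclic     : Acyclic P
      parent⇒arc  : ∀ {x y} → P x ≡ just y → Σ[ e ∈ Arc ] (e ∈ₛ S × src Γ e ≡ y × tgt Γ e ≡ x)
      arc⇒parent  : ∀ {e} → e ∈ₛ S → P (tgt Γ e) ≡ just (src Γ e)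
      in-degree≤1 : ∀ {e e′} → e ∈ₛ S → e′ ∈ₛ S → tgt Γ e ≡ tgt Γ e′ → e ≡ e′

  module _ {P : Parents} (isParentMap : IsParentMapOf P) where
    open IsParentMapOf isParentMap

    ancestor⇒reach : ∀ {a x} → Ancestor P a x → Reach Γ S a x
    ancestor⇒reach here = here
    ancestor⇒reach (up Px≡y a∣y) with parent⇒arc Px≡y
    ... | e , e∈S , s≡y , ≡.refl = reach-snoc (ancestor⇒reach a∣y) e e∈S s≡y

    rootAbove : ∀ {x} → Rooted P x → Σ[ r ∈ Fin n ] (Ancestor P r x × P r ≡ nothing)
    rootAbove {x} (root Px≡∅) = x , here , Px≡∅
    rootAbove (up Px≡y rooted) = let r , r∣y , Pr≡∅ = rootAbove rooted in r , up Px≡y r∣y , Pr≡∅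

    -- A walk cannot leave the tree below a root: its backward arcs lead to parents, which
    -- stay below r because r itself has no parent.
    walk-belowRoot : ∀ {r u v es} → P r ≡ nothing → Walk u v es → Ancestor P r u → Ancestor P r v
    walk-belowRoot Pr≡∅ nil r∣u = r∣u
    walk-belowRoot {r} Pr≡∅ (fwd e e∈S ≡.refl w) r∣u = walk-belowRoot Pr≡∅ w (up (arc⇒parent e∈S) r∣u)
    walk-belowRoot {r} Pr≡∅ (bwd e e∈S ≡.refl w) here = ⊥-elim (nothing≢just (≡.trans (≡.sym Pr≡∅) (arc⇒parent e∈S)))
    walk-belowRoot {r} Pr≡∅ (bwd e e∈S ≡.refl w) (up Pt≡y r∣y) =
      walk-belowRoot Pr≡∅ w (≡.subst (Ancestor P r) (just-injective (≡.trans (≡.sym Pt≡y) (arc⇒parent e∈S))) r∣y)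

    -- The same below tgt e, for walks not using e: by in-degree ≤ 1, e is the only arc
    -- of S leaving the subtree of tgt e upwards.
    walk-belowArc : ∀ {e} → e ∈ₛ S → ∀ {z y es} → Walk z y es → e ∉ˡ es →
                    Ancestor P (tgt Γ e) z → Ancestor P (tgt Γ e) y
    walk-belowArc e∈S nil _ t∣z = t∣z
    walk-belowArc e∈S (fwd e′ e′∈S ≡.refl w) e∉ t∣z = walk-belowArc e∈S w (e∉ ∘ there) (up (arc⇒parent e′∈S) t∣z)
    walk-belowArc e∈S (bwd e′ e′∈S t≡ w) e∉ here = ⊥-elim (e∉ (here (in-degree≤1 e∈S e′∈S (≡.sym t≡))))
    walk-belowArc e∈S (bwd e′ e′∈S ≡.refl w) e∉ (up Pt≡y t∣y) =
      walk-belowArc e∈S w (e∉ ∘ there) (≡.subst (Ancestor P _) (just-injective (≡.trans (≡.sym Pt≡y) (arc⇒parent e′∈S))) t∣y)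

    -- a walk either uses a forward arc, or it only climbs from child to parent
    firstForward : ∀ {x y es} → Walk x y es →
      (Σ[ pre ∈ List Arc ] Σ[ e ∈ Arc ] Σ[ post ∈ List Arc ]
         (es ≡ pre ++ e ∷ post × Walk x (src Γ e) pre × e ∈ₛ S × Walk (tgt Γ e) y post))
      ⊎ (Ancestor P y x × (es ≢ [] → Σ[ z ∈ Fin n ] (P x ≡ just z × Ancestor P y z)))
    firstForward nil = inj₂ (here , λ []≢[] → ⊥-elim ([]≢[] ≡.refl))
    firstForward (fwd e e∈S s≡x w) = inj₁ ([] , e , _ , ≡.refl , nil≡ (≡.sym s≡x) , e∈S , w)
    firstForward (bwd e e∈S ≡.refl w) with firstForward w
    ... | inj₁ (pre , e′ , post , ≡.refl , w₁ , e′∈S , w₂) =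
      inj₁ (e ∷ pre , e′ , post , ≡.refl , bwd e e∈S ≡.refl w₁ , e′∈S , w₂)
    ... | inj₂ (y∣s , _) = inj₂ (up (arc⇒parent e∈S) y∣s , λ _ → src Γ e , arc⇒parent e∈S , y∣s)

    ∉-split : ∀ (pre : List Arc) {e post} → Unique (pre ++ e ∷ post) → e ∉ˡ pre × e ∉ˡ post
    ∉-split []        (e∉post ∷ _) = (λ ()) , λ e∈post → All.lookup e∉post e∈post ≡.refl
    ∉-split (x ∷ pre) (x∉ ∷ uniq) with ∉-split pre uniq
    ... | e∉pre , e∉post =
      (λ { (here ≡.refl) → All.lookup x∉ (∈-++⁺ʳ pre (here ≡.refl)) ≡.refl ; (there e∈pre) → e∉pre e∈pre }) , e∉post

    -- A closed trail with a forward arc e would lead from tgt e back to src e, the parent of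
    -- tgt e, inside the subtree of tgt e; one without forward arcs climbs back to its start.
    forest : IsDirectedForest Γ S
    forest u []       w uniq = ≡.refl
    forest u (_ ∷ es) w uniq with firstForward w
    ... | inj₂ (_ , climbs) with climbs (λ ())
    ...   | z , Pu≡z , u∣z = ⊥-elim (no-cycle (acyclic z) u∣z Pu≡z here)
    forest u (_ ∷ es) w uniq | inj₁ (pre , e , post , eq , w₁ , e∈S , w₂) with ∉-split pre (≡.subst Unique eq uniq)
    ... | e∉pre , e∉post =
      ⊥-elim (no-cycle (acyclic (src Γ e)) (walk-belowArc e∈S w₁ e∉pre (walk-belowArc e∈S w₂ e∉post here))
                       (arc⇒parent e∈S) here)

    diverging : ∀ u → ∃ λ r → DivergesFrom Γ S r u
    diverging u with rootAbove (acyclic u)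
    ... | r , r∣u , Pr≡∅ =
      r , reach⇒walk (ancestor⇒reach r∣u) , λ v (_ , w) → ancestor⇒reach (walk-belowRoot Pr≡∅ w r∣u)

    inF : ∀ {i j} → P i ≡ nothing → Ancestor P i j → InF Γ i j S
    inF Pi≡∅ i∣j = (forest , diverging) , reach⇒walk (ancestor⇒reach i∣j) ,
                   ([] , nil) , λ v (_ , w) → ancestor⇒reach (walk-belowRoot Pi≡∅ w here)

  module _ {i j : Fin n} (inF : InF Γ i j S) where
    private
      isForest : IsDirectedForest Γ S
      isForest = proj₁ (proj₁ inF)

      -- an arc e into v together with a walk from v to src e that never enters v is a cycle
      noReturn : ∀ {v e es} → e ∈ₛ S → tgt Γ e ≡ v → Walk v (src Γ e) es → NoArcInto v es → ⊥
      noReturn e∈S ≡.refl w noEntry = forest-arc-isBridge isForest e∈S w λ e∈ → All.lookup noEntry e∈ ≡.refl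

      -- two arcs into the same vertex, whose sources are joined avoiding that vertex, close a cycle
      twoArcsInto : ∀ {e e′ r es es′} → e ∈ₛ S → e′ ∈ₛ S → e ≢ e′ → tgt Γ e ≡ tgt Γ e′ →
        Walk r (src Γ e) es → NoArcInto (tgt Γ e) es → Walk r (src Γ e′) es′ → NoArcInto (tgt Γ e) es′ → ⊥
      twoArcsInto {e} {e′} e∈S e′∈S e≢e′ t≡t′ w noEntry w′ noEntry′ with reverse w
      ... | _ , w⁻¹ , ⊆w with toTrail (w⁻¹ ++ʷ w′)
      ... | es , trail , uniq , ⊆w⁻¹w′ =
        ⊥-elim (nonEmpty (isForest (src Γ e′) (e′ ∷ e ∷ es) (fwd e′ e′∈S ≡.refl (bwd e e∈S t≡t′ trail))
             (((e≢e′ ∘ ≡.sym) ∷ All.map (λ { t≢ ≡.refl → t≢ (≡.sym t≡t′) }) noEntry″) ∷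
              (All.map (λ { t≢ ≡.refl → t≢ ≡.refl }) noEntry″ ∷ uniq))))
        where
        noEntry″ : NoArcInto (tgt Γ e) es
        noEntry″ = All.anti-mono ⊆w⁻¹w′ (All.++⁺ (All.anti-mono ⊆w noEntry) noEntry′)
        nonEmpty : e′ ∷ e ∷ es ≢ []
        nonEmpty ()

    inF⇒reach : Reach Γ S i j
    inF⇒reach = proj₂ (proj₂ (proj₂ inF)) j (proj₁ (proj₂ inF))

    inF⇒noArcInto-i : ∀ {e} → e ∈ₛ S → tgt Γ e ≢ i
    inF⇒noArcInto-i {e} e∈S t≡i with lastEntry (proj₂ (proj₂ (proj₂ inF)) (src Γ e) (e ∷ [] , bwd e e∈S t≡i nil)) i
    ... | inj₁ (_ , w , noEntry) = noReturn e∈S t≡i w noEntry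
    ... | inj₂ (_ , w , noEntry) = noReturn e∈S t≡i w noEntry

    inF⇒in-degree≤1 : ∀ {e e′} → e ∈ₛ S → e′ ∈ₛ S → tgt Γ e ≡ tgt Γ e′ → e ≡ e′
    inF⇒in-degree≤1 {e} {e′} e∈S e′∈S t≡t′ with e ≟ e′
    ... | yes e≡e′ = e≡e′
    ... | no e≢e′ with proj₂ (proj₁ inF) (tgt Γ e)
    ... | r , _ , reach with lastEntry (reach (src Γ e) (e ∷ [] , bwd e e∈S ≡.refl nil)) (tgt Γ e)
                           | lastEntry (reach (src Γ e′) (e′ ∷ [] , bwd e′ e′∈S (≡.sym t≡t′) nil)) (tgt Γ e)
    ... | inj₂ (_ , w , noEntry) | _                        = ⊥-elim (noReturn e∈S ≡.refl w noEntry)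
    ... | inj₁ _                 | inj₂ (_ , w , noEntry)   = ⊥-elim (noReturn e′∈S (≡.sym t≡t′) w noEntry)
    ... | inj₁ (_ , w , noEntry) | inj₁ (_ , w′ , noEntry′) =
      ⊥-elim (twoArcsInto e∈S e′∈S e≢e′ t≡t′ w noEntry w′ noEntry′)

module ScanCorrectness {a} {A : Set a} {n : ℕ} (Γ : Multidigraph A n) (i j : Fin n) (S : Subset (nArcs Γ)) where
  open ParentMaps n
  open ForestScan n i j
  open Walks Γ S
  open ParentForests Γ S
  open Arcs using (along; chosenArcs)

  -- arcs already scanned: those not listed by pending
  Done : ∀ {m} → (Fin m → Arc) → Arc → Set
  Done pending e = ∀ k → pending k ≢ e

  record Tracks {m} (pending : Fin m → Arc) (p : Parents) : Set where
    field
      parent⇒arc  : ∀ {x y} → p x ≡ just y → Σ[ e ∈ Arc ] (e ∈ₛ S × Done pending e × src Γ e ≡ y × tgt Γ e ≡ x)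
      arc⇒parent  : ∀ {e} → e ∈ₛ S → Done pending e → p (tgt Γ e) ≡ just (src Γ e)
      in-degree≤1 : ∀ {e e′} → e ∈ₛ S → e′ ∈ₛ S → Done pending e → Done pending e′ →
                    tgt Γ e ≡ tgt Γ e′ → e ≡ e′
  open Tracks

  tracks-start : Tracks (λ e → e) noParents
  tracks-start = record
    { parent⇒arc  = λ ()
    ; arc⇒parent  = λ {e} _ done → ⊥-elim (done e ≡.refl)
    ; in-degree≤1 = λ {e} _ _ done _ _ → ⊥-elim (done e ≡.refl)
    }

  tracks-finish : ∀ {pending : Fin 0 → Arc} {p} → Acyclic p → Tracks pending p → IsParentMapOf p
  tracks-finish acyclic tracks = record
    { acyclic     = acyclic
    ; parent⇒arc  = λ px≡y → let e , e∈S , _ , s≡y , t≡x = parent⇒arc tracks px≡y in e , e∈S , s≡y , t≡x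
    ; arc⇒parent  = λ e∈S → arc⇒parent tracks e∈S λ ()
    ; in-degree≤1 = λ e∈S e′∈S → in-degree≤1 tracks e∈S e′∈S (λ ()) (λ ())
    }

  module _ {m} (pending : Fin (suc m) → Arc) where
    private
      e₀ = pending zero
      done-suc : ∀ {e} → e₀ ≢ e → Done (pending ∘ suc) e → Done pending e
      done-suc e₀≢e done zero    = e₀≢e
      done-suc e₀≢e done (suc k) = done k

    tracks-skip : ∀ {p} → lookup S e₀ ≡ false → Tracks pending p → Tracks (pending ∘ suc) p
    tracks-skip {p} e₀∉S tracks = record
      { parent⇒arc  = λ px≡y → let e , e∈S , done , s≡y , t≡x = parent⇒arc tracks px≡y in
                                e , e∈S , done ∘ suc , s≡y , t≡x
      ; arc⇒parent  = λ e∈S done → arc⇒parent tracks e∈S (done-suc (e₀≢ e∈S) done)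
      ; in-degree≤1 = λ e∈S e′∈S done done′ →
                        in-degree≤1 tracks e∈S e′∈S (done-suc (e₀≢ e∈S) done) (done-suc (e₀≢ e′∈S) done′)
      }
      where
      e₀≢ : ∀ {e} → e ∈ₛ S → e₀ ≢ e
      e₀≢ e∈S ≡.refl with ≡.trans (≡.sym e₀∉S) ([]=⇒lookup e∈S)
      ... | ()

    tracks-add : Injective _≡_ _≡_ pending → ∀ {p} → e₀ ∈ₛ S → p (tgt Γ e₀) ≡ nothing → Tracks pending p →
                 Tracks (pending ∘ suc) (reparent p (tgt Γ e₀) (just (src Γ e₀)))
    tracks-add injective {p} e₀∈S pv≡∅ tracks =
      record { parent⇒arc = parent⇒arc′ ; arc⇒parent = arc⇒parent′ ; in-degree≤1 = in-degree≤1′ }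
      where
      v = tgt Γ e₀
      p′ = reparent p v (just (src Γ e₀))
      e₀-done : Done (pending ∘ suc) e₀
      e₀-done k pk≡e₀ with injective pk≡e₀
      ... | ()
      -- before the update, v had no parent, so no scanned arc of S entered v
      notInto-v : ∀ {e} → e ∈ₛ S → Done pending e → tgt Γ e ≢ v
      notInto-v e∈S done t≡v =
        nothing≢just (≡.trans (≡.sym pv≡∅) (≡.trans (≡.cong p (≡.sym t≡v)) (arc⇒parent tracks e∈S done)))
      parent⇒arc′ : ∀ {x y} → p′ x ≡ just y →
                    Σ[ e ∈ Arc ] (e ∈ₛ S × Done (pending ∘ suc) e × src Γ e ≡ y × tgt Γ e ≡ x)
      parent⇒arc′ {x} p′x≡y with x ≟ v
      ... | yes ≡.refl = e₀ , e₀∈S , e₀-done , just-injective p′x≡y , ≡.refl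
      ... | no _ = let e , e∈S , done , s≡y , t≡x = parent⇒arc tracks p′x≡y in e , e∈S , done ∘ suc , s≡y , t≡x
      arc⇒parent′ : ∀ {e} → e ∈ₛ S → Done (pending ∘ suc) e → p′ (tgt Γ e) ≡ just (src Γ e)
      arc⇒parent′ {e} e∈S done with e ≟ e₀
      ... | yes ≡.refl = reparent-same p v _
      ... | no e≢e₀ = ≡.trans (reparent-other p v _ (notInto-v e∈S done′)) (arc⇒parent tracks e∈S done′)
        where done′ = done-suc (e≢e₀ ∘ ≡.sym) done
      in-degree≤1′ : ∀ {e e′} → e ∈ₛ S → e′ ∈ₛ S → Done (pending ∘ suc) e → Done (pending ∘ suc) e′ →
                     tgt Γ e ≡ tgt Γ e′ → e ≡ e′
      in-degree≤1′ {e} {e′} e∈S e′∈S done done′ t≡t′ with e ≟ e₀ | e′ ≟ e₀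
      ... | yes e≡e₀ | yes e′≡e₀ = ≡.trans e≡e₀ (≡.sym e′≡e₀)
      ... | yes ≡.refl | no e′≢e₀ = ⊥-elim (notInto-v e′∈S (done-suc (e′≢e₀ ∘ ≡.sym) done′) (≡.sym t≡t′))
      ... | no e≢e₀ | yes ≡.refl = ⊥-elim (notInto-v e∈S (done-suc (e≢e₀ ∘ ≡.sym) done) t≡t′)
      ... | no e≢e₀ | no e′≢e₀ =
        in-degree≤1 tracks e∈S e′∈S (done-suc (e≢e₀ ∘ ≡.sym) done) (done-suc (e′≢e₀ ∘ ≡.sym) done′) t≡t′

  private
    injective-suc : ∀ {m} {pending : Fin (suc m) → Arc} → Injective _≡_ _≡_ pending → Injective _≡_ _≡_ (pending ∘ suc)
    injective-suc injective eq = suc-injective (injective eq)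

    ancestor⇒scannedWalk : ∀ {m} {pending : Fin m → Arc} {p} → Tracks pending p → ∀ {v u} → Ancestor p v u →
                           Σ[ es ∈ List Arc ] (Walk v u es × All (Done pending) es)
    ancestor⇒scannedWalk tracks here = [] , nil , []
    ancestor⇒scannedWalk tracks (up px≡y v∣y) with parent⇒arc tracks px≡y | ancestor⇒scannedWalk tracks v∣y
    ... | e , e∈S , done , s≡y , t≡x | es , w , allDone =
      es ++ e ∷ [] , w ++ʷ fwd e e∈S s≡y (nil≡ t≡x) , All.++⁺ allDone (done ∷ [])

  -- each arc of the scan is accepted, since an inF-forest has in-degree ≤ 1, no arc into i and no cycle
  accepts-inF : InF Γ i j S → ∀ {m} (pending : Fin m → Arc) → Injective _≡_ _≡_ pending →
    ∀ {p} (acyclic : Acyclic p) → Tracks pending p →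
    acceptsArcs p acyclic (chosenArcs (along Γ pending) (lookup S ∘ pending)) ≡ true
  accepts-inF inF {zero} pending _ {p} acyclic tracks =
    Equivalence.from (does≡true⇔ (ancestor? p i (acyclic j))) (reach⇒ancestor (inF⇒reach inF))
    where
    reach⇒ancestor : ∀ {u x} → Reach Γ S u x → Ancestor p u x
    reach⇒ancestor here                   = here
    reach⇒ancestor (step e e∈S ≡.refl r) = Ancestor-trans (up (arc⇒parent tracks e∈S λ ()) here) (reach⇒ancestor r)
  accepts-inF inF {suc m} pending injective {p} acyclic tracks with lookup S (pending zero) in e₀∈?
  ... | false = accepts-inF inF (pending ∘ suc) (injective-suc injective) acyclic (tracks-skip pending e₀∈? tracks)
  ... | true with p (tgt Γ (pending zero)) in pv≡ | tgt Γ (pending zero) ≟ i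
                | ancestor? p (tgt Γ (pending zero)) (acyclic (src Γ (pending zero)))
  ...   | just _  | _       | _       with parent⇒arc tracks pv≡
  ...     | e , e∈S , done , _ , t≡v =
    ⊥-elim (done zero (≡.sym (inF⇒in-degree≤1 inF e∈S (lookup⇒[]= _ S e₀∈?) t≡v)))
  accepts-inF inF {suc m} pending injective {p} acyclic tracks
      | true | nothing | yes v≡i | _ = ⊥-elim (inF⇒noArcInto-i inF (lookup⇒[]= _ S e₀∈?) v≡i)
  accepts-inF inF {suc m} pending injective {p} acyclic tracks
      | true | nothing | no _ | yes v∣u with ancestor⇒scannedWalk tracks v∣u
  ... | es , w , allDone = ⊥-elim (forest-arc-isBridge (proj₁ (proj₁ inF)) (lookup⇒[]= _ S e₀∈?) w
                                                       λ e₀∈es → All.lookup allDone e₀∈es zero ≡.refl)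
  accepts-inF inF {suc m} pending injective {p} acyclic tracks
      | true | nothing | no _ | no v∤u =
    accepts-inF inF (pending ∘ suc) (injective-suc injective) (acyclic-reparent acyclic v∤u)
                (tracks-add pending injective (lookup⇒[]= _ S e₀∈?) pv≡ tracks)

  inF-accepted : ∀ {m} (pending : Fin m → Arc) → Injective _≡_ _≡_ pending →
    ∀ {p} (acyclic : Acyclic p) → p i ≡ nothing → Tracks pending p →
    acceptsArcs p acyclic (chosenArcs (along Γ pending) (lookup S ∘ pending)) ≡ true → InF Γ i j S
  inF-accepted {zero} pending _ {p} acyclic pi≡∅ tracks accepted =
    inF (tracks-finish acyclic tracks) pi≡∅ (Equivalence.to (does≡true⇔ (ancestor? p i (acyclic j))) accepted)
  inF-accepted {suc m} pending injective {p} acyclic pi≡∅ tracks with lookup S (pending zero) in e₀∈?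
  ... | false = inF-accepted (pending ∘ suc) (injective-suc injective) acyclic pi≡∅ (tracks-skip pending e₀∈? tracks)
  ... | true with p (tgt Γ (pending zero)) in pv≡ | tgt Γ (pending zero) ≟ i
                | ancestor? p (tgt Γ (pending zero)) (acyclic (src Γ (pending zero)))
  ...   | just _  | _      | _      = λ ()
  ...   | nothing | yes _  | _      = λ ()
  ...   | nothing | no _   | yes _  = λ ()
  ...   | nothing | no v≢i | no v∤u =
    inF-accepted (pending ∘ suc) (injective-suc injective) (acyclic-reparent acyclic v∤u)
                 (≡.trans (reparent-other p _ _ (v≢i ∘ ≡.sym)) pi≡∅)
                 (tracks-add pending injective (lookup⇒[]= _ S e₀∈?) pv≡ tracks)

  accepts⇔inF : acceptsArcs noParents acyclic-noParents (chosenArcs Γ (lookup S)) ≡ true ⇔ InF Γ i j S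
  accepts⇔inF = mk⇔ (inF-accepted (λ e → e) (λ eq → eq) acyclic-noParents ≡.refl tracks-start)
                    (λ inF → accepts-inF inF (λ e → e) (λ eq → eq) acyclic-noParents tracks-start)

theorem4 : ∀ {c ℓ : Level} (R : CommutativeRing c ℓ) (n : ℕ)
           (Γ : Multidigraph (CommutativeRing.Carrier R) n) (i j : Fin n)
           (Fs : List (Subset (nArcs Γ))) →
           Unique Fs →
           (∀ S → (S ∈ˡ Fs) ⇔ InF Γ i j S) →
           CommutativeRing._≈_ R (cofactor R (Wmat R Γ) i j) (sumList R (map (ε R Γ) Fs))
theorem4 R (suc k) Γ i j Fs unique Fs⇔F = begin
  cofactor R (Wmat R Γ) i j                  ≈⟨ cofactor≈det-setRow (Wmat R Γ) i j ⟩
  unitRowDet i (Wmat R Γ) j                  ≈⟨ unitRowDet-cong j (λ r _ → W≈arcMatrix r) ⟩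
  unitRowDet i (arcMatrix Γ noParents) j     ≈⟨ unitRowDet≈forestSum Γ acyclic-noParents ≡.refl ⟩
  forestSum Γ noParents acyclic-noParents    ≈⟨ sumSubsets-cong (nArcs Γ) (λ S → reflexive (≡.cong (if_then ε R Γ S else 0#)
                                                                                                  (⇔→≡ (accepted⇔listed S)))) ⟩
  sumSubsets (nArcs Γ) (λ S → if does (S ∈ˡ? Fs) then ε R Γ S else 0#)
                                             ≈⟨ sumList≈sumSubsets (ε R Γ) Fs unique ⟨
  sumList R (map (ε R Γ) Fs)                 ∎
  where
  open CommutativeRing R
  open Determinants R
  open ParentMaps (suc k)
  open ParentMatrices R (suc k)
  open SubsetSums R
  open ArcMatrices R
  open ArcExpansion R i j
  open KirchhoffRows R Γ
  open ForestScan (suc k) i j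
  open import Relation.Binary.Reasoning.Setoid setoid
  accepted⇔listed : ∀ S → acceptsArcs noParents acyclic-noParents (Arcs.chosenArcs Γ (lookup S)) ≡ true ⇔
                          does (S ∈ˡ? Fs) ≡ true
  accepted⇔listed S = ⇔.trans (ScanCorrectness.accepts⇔inF Γ i j S) (⇔.sym (⇔.trans (does≡true⇔ (S ∈ˡ? Fs)) (Fs⇔F S)))
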